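{- Let $m\ge2$, let $d_1,\dots,d_m$ be positive integers, with the notation described in the context, and define for $s\in\xi_m+\mathbb Z$ $${\cal R}^m_m(s)=\sum_{l=1}^{m-1}\frac{\tau_m^{\,l-1}}{l}\sum_{p=0}^{\delta_m-1}{\cal B}_l\!\left(1-\frac{\lambda_p}{\delta_m}\right)R^{m-1}_{m-l}(s-\lambda_p d_m).$$ Then for all $s\in\xi_m+\mathbb Z$, $${\cal R}^m_m(s)-{\cal R}^m_m(s-d_m)=\sum_{j=1}^{m-1}\left\{(-d_m)^{j}R^m_{m-j}(s-d_m)+\left(-\frac{d_m}{2}\right)^{j-1}R^{m-1}_{m-j}\!\left(s-\frac{d_m}{2}\right)\right\}.$$
   Context: For $1\le k\le m$ let ${\bf d}^k=(d_1,\dots,d_k)$, $\tau_k=\mathrm{lcm}(d_1,\dots,d_k)$, $\xi_k=\frac12(d_1+\dots+d_k)$. For an integer $s\ge0$, $W(s,{\bf d}^k)$ is the coefficient of $t^s$ in $\prod_{r=1}^k(1-t^{d_r})^{ -1}$, and $\widetilde W(\cdot,{\bf d}^k):\mathbb Z\to\mathbb Q$ is the unique function of the form $\sum_{i=0}^{k-1}c_i(s)s^i$ with periodic $c_i$ agreeing with $W(s,{\bf d}^k)$ for all $s\ge0$. Define $V_k:\xi_k+\mathbb Z\to\mathbb Q$ by $V_k(s)=\widetilde W(s-\xi_k,{\bf d}^k)$. There are unique $\tau_k$-periodic functions $R^k_1,\dots,R^k_k:\xi_k+\mathbb Z\to\mathbb Q$ with $V_k(s)=R^k_k(s)+\sum_{j=1}^{k-1}R^k_j(s)\,s^{k-j}$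 for all $s\in\xi_k+\mathbb Z$. Put $\delta_m=\tau_m/d_m$, $\lambda_p=p+\frac12$, and let ${\cal B}_l$ be the Bernoulli polynomials (generating function $te^{xt}/(e^t-1)=\sum_l{\cal B}_l(x)t^l/l!$). -}

module Defs where

open import Data.Nat as ℕ using (ℕ; zero; suc; NonZero)
open import Data.Nat.DivMod as ℕD using ()
open import Data.Nat.LCM using (lcm)
open import Data.Nat.Divisibility using (_∣?_)
open import Data.Nat.Combinatorics using (_C_)
open import Data.Integer as ℤ using (ℤ; +_)
open import Data.Rational using (ℚ; 0ℚ; 1ℚ; _+_; _*_; _-_; -_; _/_)
open import Data.List using (List; []; _∷_; length; _++_; [_])
open import Data.Fin using (Fin; toℕ)
open import Data.Product using (Σ; _×_; ∃)
open import Relation.Nullary using (does)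
open import Data.Bool using (if_then_else_)
open import Relation.Binary.PropositionalEquality using (_≡_)

Σ< : ℕ → (ℕ → ℚ) → ℚ
Σ< zero    f = 0ℚ
Σ< (suc n) f = Σ< n f + f n

Σ1 : ℕ → (ℕ → ℚ) → ℚ
Σ1 n f = Σ< n (λ i → f (suc i))

pow : ℚ → ℕ → ℚ
pow x zero    = 1ℚ
pow x (suc n) = pow x n * x

ℕ→ℚ : ℕ → ℚ
ℕ→ℚ n = (+ n) / 1

ℤ→ℚ : ℤ → ℚ
ℤ→ℚ z = z / 1

-- 1/n for n ≥ 1 (the value at 0 is never used)
inv : ℕ → ℚ
inv zero    = 0ℚ
inv (suc n) = (+ 1) / suc n

half : ℕ → ℚ
half n = (+ n) / 2

-- Bernoulli numbers and polynomials (convention B₁ = -1/2, i.e. the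
-- generating function t e^{xt}/(e^t-1) = Σ B_l(x) t^l / l!).
-- Bernoulli numbers: B₀ = 1, Σ_{k=0}^{n} C(n+1,k) B_k = 0 for n ≥ 1.

nth : List ℚ → ℕ → ℚ
nth []       _       = 0ℚ
nth (x ∷ xs) zero    = x
nth (x ∷ xs) (suc i) = nth xs i

-- next n bs = B_n, given bs = [B_0, ..., B_{n-1}]
nextBern : ℕ → List ℚ → ℚ
nextBern zero    bs = 1ℚ
nextBern (suc n) bs =
  - (inv (suc (suc n)) * Σ< (suc n) (λ k → ℕ→ℚ (suc (suc n) C k) * nth bs k))

bernList : ℕ → List ℚ
bernList zero    = []
bernList (suc n) = bernList n ++ [ nextBern n (bernList n) ]

bernNum : ℕ → ℚ
bernNum n = nth (bernList (suc n)) n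

bernPoly : ℕ → ℚ → ℚ
bernPoly n x = Σ< (suc n) (λ k → ℕ→ℚ (n C k) * bernNum k * pow x (n ℕ.∸ k))

-- W(s, d): coefficient of t^s in Π_r (1 - t^{d_r})^{-1}

Series : Set
Series = ℕ → ℕ

sumN : ℕ → (ℕ → ℕ) → ℕ
sumN zero    f = 0
sumN (suc n) f = sumN n f ℕ.+ f n

conv : Series → Series → Series
conv f g n = sumN (suc n) (λ i → f i ℕ.* g (n ℕ.∸ i))

-- (1 - t^d)^{-1} = Σ_{j ≥ 0} t^{j d}
geom : ℕ → Series
geom d n = if does (d ∣? n) then 1 else 0

one : Series
one zero    = 1
one (suc _) = 0

prodSeries : List ℕ → Series
prodSeries []       = one
prodSeries (d ∷ ds) = conv (geom d) (prodSeries ds)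

W : ℕ → List ℕ → ℕ
W s ds = prodSeries ds s

τ : List ℕ → ℕ
τ []       = 1
τ (d ∷ ds) = lcm d (τ ds)

sumL : List ℕ → ℕ
sumL []       = 0
sumL (d ∷ ds) = d ℕ.+ sumL ds

ξ : List ℕ → ℚ
ξ ds = half (sumL ds)

-- W̃(·, d): a function ℤ → ℚ of the form Σ_{i=0}^{k-1} c_i(s) s^i with
-- periodic c_i, agreeing with W(s, d) for s ≥ 0 (it is unique).

IsWtilde : List ℕ → (ℤ → ℚ) → Set
IsWtilde ds Wt =
  Σ ℕ λ P → NonZero P × Σ (ℕ → ℤ → ℚ) λ c →
    (∀ i z → c i (z ℤ.+ + P) ≡ c i z) ×
    (∀ z → Wt z ≡ Σ< (length ds) (λ i → c i z * pow (ℤ→ℚ z) i)) ×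
    (∀ (s : ℕ) → Wt (+ s) ≡ ℕ→ℚ (W s ds))

-- R_1,…,R_k (given as R : ℕ → ℚ → ℚ, only R 1 … R k are relevant, and
-- only on the coset ξ_k + ℤ, whose points are written ξ_k + z, z : ℤ)
-- are τ_k-periodic and V_k(s) = R_k(s) + Σ_{j=1}^{k-1} R_j(s) s^{k-j}
-- where V_k(ξ_k + z) = W̃(z).
IsRdecomp : List ℕ → (ℤ → ℚ) → (ℕ → ℚ → ℚ) → Set
IsRdecomp ds Wt R =
  (∀ j → 1 ℕ.≤ j → j ℕ.≤ length ds → ∀ (z : ℤ) →
     R j (ξ ds + ℤ→ℚ z + ℕ→ℚ (τ ds)) ≡ R j (ξ ds + ℤ→ℚ z)) ×
  (∀ (z : ℤ) → let s = ξ ds + ℤ→ℚ z in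
     Wt z ≡ R (length ds) s
            + Σ1 (length ds ℕ.∸ 1) (λ j → R j s * pow s (length ds ℕ.∸ j)))

-- The function 𝓡^m_m, for d^m = ds ++ [dm], m = length ds + 1,
-- built from R^{m-1} (given as Rm1).

λ' : ℕ → ℚ
λ' p = ℕ→ℚ p + (+ 1) / 2

δ : (ds : List ℕ) (dm : ℕ) .{{_ : NonZero dm}} → ℕ
δ ds dm = τ (ds ++ [ dm ]) ℕD./ dm

calR : (ds : List ℕ) (dm : ℕ) .{{_ : NonZero dm}} → (ℕ → ℚ → ℚ) → ℚ → ℚ
calR ds dm Rm1 s =
  let m  = suc (length ds)
      τm = τ (ds ++ [ dm ])
      δm = δ ds dm
  in Σ1 (m ℕ.∸ 1) λ l →
       pow (ℕ→ℚ τm) (l ℕ.∸ 1) * inv l *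
       Σ< δm (λ p → bernPoly l (1ℚ - λ' p * inv δm)
                    * Rm1 (m ℕ.∸ l) (s - λ' p * ℕ→ℚ dm))

-- For y ∈ ℚ let Ψ(y, s) be the sum defining 𝓡^m_m(s) with every Bernoulli argument shifted by
-- y/τₘ, so 𝓡^m_m = Ψ(0, ·). Replacing (y, s) by (y − dₘ, s − dₘ) turns p into p + 1 in the inner
-- sum, which therefore telescopes, and Bₗ(x + 1) − Bₗ(x) = l x^(l−1) turns what is left into
--   Ψ(y, s) − Ψ(y − dₘ, s − dₘ) = Σₗ (y − dₘ/2)^(l−1) R^(m−1)_(m−l)(s − dₘ/2).
-- For y = s the right side is V_(m−1)(s − dₘ/2) = W̃(s − ξₘ, d^(m−1)), so the recurrence
-- W(n, d^m) = W(n, d^(m−1)) + W(n − dₘ, d^m) makes V_m(s) − Ψ(s, s) dₘ-periodic. For fixed s,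
-- y ↦ Σⱼ R^m_j(s) y^(m−j) − Ψ(y, s) is a polynomial, and by τₘ-periodicity of all the R's it agrees
-- with that periodic function at the infinitely many y ∈ s + τₘ ℕ, so it is constant. Comparing
-- y = 0 with y = −dₘ gives the R^m part of the identity, and y = 0 in the telescoping identity
-- the R^(m−1) part.

module Submission where

open import Defs
open import Data.Nat as ℕ using (ℕ; zero; suc; z≤n; s≤s; NonZero; _!; _≤_; _∸_)
import Data.Nat.Properties as ℕₚ
open import Data.Nat.Combinatorics
  using (_C_; nCk≡n!/k![n-k]!; k![n∸k]!∣n!; nCk≡nC[n∸k]; nC1≡n; nCn≡1; k>n⇒nCk≡0; nCk+nC[k+1]≡[n+1]C[k+1])
open import Data.Nat.DivMod using (m/n*n≡m; m*[n/m]≡n)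
open import Data.Nat.Divisibility using (_∣_; _∣?_; divides; ∣-trans; _∣0; n∣n; ∣⇒≤; ∣m+n∣m⇒∣n; ∣m∣n⇒∣m+n; 1∣_)
open import Data.Nat.LCM using (lcm; m∣lcm[m,n]; n∣lcm[m,n]; lcm-least; gcd*lcm)
open import Data.Nat.GCD using (gcd)
import Data.Nat.Solver as ℕ-Solver
open import Data.Integer as ℤ using (ℤ; +_; -[1+_])
import Data.Integer.Properties as ℤₚ
import Data.Integer.Solver as ℤ-Solver
open import Data.Rational hiding (truncate; NonZero; _≤_)
open import Data.Rational.Properties
open import Data.Rational.Solver
import Data.Rational.Unnormalised as ℚᵘ
import Data.Rational.Unnormalised.Properties as ℚᵘₚ
open import Data.List using (List; []; _∷_; length; _++_; [_])
import Data.List.Properties as Listₚ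
open import Data.List.Relation.Unary.All using (All; []; _∷_)
open import Data.List.Relation.Unary.All.Properties using (++⁺)
open import Data.Product using (Σ; ∃; _×_; _,_; proj₁; proj₂)
open import Data.Sum using (inj₁; inj₂)
open import Data.Empty using (⊥-elim)
open import Function using (_∘_)
open import Function.Definitions using (Injective)
open import Relation.Nullary using (yes; no)
open import Relation.Nullary.Decidable using (dec-true; dec-false)
open import Relation.Binary.PropositionalEquality hiding ([_])
import Algebra.Properties.Group as GroupProperties
open import Algebra.Bundles using (AbelianGroup)

open +-*-Solver

private
  module ℚ+ = GroupProperties +-0-group
  module ℕS = ℕ-Solver.+-*-Solver
  module ℤS = ℤ-Solver.+-*-Solver
  module ℤ+ = GroupProperties (AbelianGroup.group ℤₚ.+-0-abelianGroup)

-- Embeddings of ℕ and ℤ into ℚ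

private
  toℚᵘ-ℤ→ℚ : ∀ z → toℚᵘ (ℤ→ℚ z) ℚᵘ.≃ ℚᵘ.mkℚᵘ z 0
  toℚᵘ-ℤ→ℚ z = toℚᵘ-fromℚᵘ (ℚᵘ.mkℚᵘ z 0)

ℤ→ℚ-homo-+ : ∀ a b → ℤ→ℚ (a ℤ.+ b) ≡ ℤ→ℚ a + ℤ→ℚ b
ℤ→ℚ-homo-+ a b = toℚᵘ-injective (begin
    toℚᵘ (ℤ→ℚ (a ℤ.+ b))               ≈⟨ toℚᵘ-ℤ→ℚ (a ℤ.+ b) ⟩
    ℚᵘ.mkℚᵘ (a ℤ.+ b) 0                ≈⟨ ℚᵘ.*≡* (cong (ℤ._* + 1) (sym (cong₂ ℤ._+_ (ℤₚ.*-identityʳ a) (ℤₚ.*-identityʳ b)))) ⟩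
    ℚᵘ.mkℚᵘ a 0 ℚᵘ.+ ℚᵘ.mkℚᵘ b 0        ≈⟨ ℚᵘₚ.+-cong (toℚᵘ-ℤ→ℚ a) (toℚᵘ-ℤ→ℚ b) ⟨
    toℚᵘ (ℤ→ℚ a) ℚᵘ.+ toℚᵘ (ℤ→ℚ b)      ≈⟨ toℚᵘ-homo-+ (ℤ→ℚ a) (ℤ→ℚ b) ⟨
    toℚᵘ (ℤ→ℚ a + ℤ→ℚ b)               ∎)
  where open ℚᵘₚ.≃-Reasoning

ℤ→ℚ-homo-* : ∀ a b → ℤ→ℚ (a ℤ.* b) ≡ ℤ→ℚ a * ℤ→ℚ b
ℤ→ℚ-homo-* a b = toℚᵘ-injective (begin
    toℚᵘ (ℤ→ℚ (a ℤ.* b))               ≈⟨ toℚᵘ-ℤ→ℚ (a ℤ.* b) ⟩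
    ℚᵘ.mkℚᵘ a 0 ℚᵘ.* ℚᵘ.mkℚᵘ b 0        ≈⟨ ℚᵘₚ.*-cong (toℚᵘ-ℤ→ℚ a) (toℚᵘ-ℤ→ℚ b) ⟨
    toℚᵘ (ℤ→ℚ a) ℚᵘ.* toℚᵘ (ℤ→ℚ b)      ≈⟨ toℚᵘ-homo-* (ℤ→ℚ a) (ℤ→ℚ b) ⟨
    toℚᵘ (ℤ→ℚ a * ℤ→ℚ b)               ∎)
  where open ℚᵘₚ.≃-Reasoning

ℤ→ℚ-homo‿- : ∀ a → ℤ→ℚ (ℤ.- a) ≡ - ℤ→ℚ a
ℤ→ℚ-homo‿- a = toℚᵘ-injective (begin
    toℚᵘ (ℤ→ℚ (ℤ.- a))    ≈⟨ toℚᵘ-ℤ→ℚ (ℤ.- a) ⟩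
    ℚᵘ.- ℚᵘ.mkℚᵘ a 0       ≈⟨ ℚᵘₚ.-‿cong (toℚᵘ-ℤ→ℚ a) ⟨
    ℚᵘ.- toℚᵘ (ℤ→ℚ a)      ≈⟨ toℚᵘ-homo‿- (ℤ→ℚ a) ⟨
    toℚᵘ (- ℤ→ℚ a)         ∎)
  where open ℚᵘₚ.≃-Reasoning

ℤ→ℚ-injective : ∀ {a b} → ℤ→ℚ a ≡ ℤ→ℚ b → a ≡ b
ℤ→ℚ-injective {a} {b} eq with ℚᵘₚ.≃-trans (ℚᵘₚ.≃-sym (toℚᵘ-ℤ→ℚ a)) (ℚᵘₚ.≃-trans (toℚᵘ-cong eq) (toℚᵘ-ℤ→ℚ b))
... | ℚᵘ.*≡* a*1≡b*1 = trans (sym (ℤₚ.*-identityʳ a)) (trans a*1≡b*1 (ℤₚ.*-identityʳ b))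

ℕ→ℚ-homo-+ : ∀ a b → ℕ→ℚ (a ℕ.+ b) ≡ ℕ→ℚ a + ℕ→ℚ b
ℕ→ℚ-homo-+ a b = ℤ→ℚ-homo-+ (+ a) (+ b)

ℕ→ℚ-homo-* : ∀ a b → ℕ→ℚ (a ℕ.* b) ≡ ℕ→ℚ a * ℕ→ℚ b
ℕ→ℚ-homo-* a b = trans (cong ℤ→ℚ (ℤₚ.pos-* a b)) (ℤ→ℚ-homo-* (+ a) (+ b))

inv-inverseˡ : ∀ n .{{_ : NonZero n}} → inv n * ℕ→ℚ n ≡ 1ℚ
inv-inverseˡ (suc n) = toℚᵘ-injective (begin
    toℚᵘ (inv (suc n) * ℕ→ℚ (suc n))                 ≈⟨ toℚᵘ-homo-* (inv (suc n)) (ℕ→ℚ (suc n)) ⟩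
    toℚᵘ (inv (suc n)) ℚᵘ.* toℚᵘ (ℕ→ℚ (suc n))       ≈⟨ ℚᵘₚ.*-cong (toℚᵘ-fromℚᵘ (ℚᵘ.mkℚᵘ (+ 1) n)) (toℚᵘ-ℤ→ℚ (+ suc n)) ⟩
    ℚᵘ.mkℚᵘ (+ 1) n ℚᵘ.* ℚᵘ.mkℚᵘ (+ suc n) 0         ≈⟨ ℚᵘ.*≡* (ℤₚ.*-assoc (+ 1) (+ suc n) (+ 1)) ⟩
    ℚᵘ.1ℚᵘ                                            ∎)
  where open ℚᵘₚ.≃-Reasoning

half≡*½ : ∀ n → half n ≡ ℕ→ℚ n * ½
half≡*½ n = toℚᵘ-injective (begin
    toℚᵘ (half n)                       ≈⟨ toℚᵘ-fromℚᵘ (ℚᵘ.mkℚᵘ (+ n) 1) ⟩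
    ℚᵘ.mkℚᵘ (+ n) 1                     ≈⟨ ℚᵘ.*≡* (cong (ℤ._* + 2) (sym (ℤₚ.*-identityʳ (+ n)))) ⟩
    ℚᵘ.mkℚᵘ (+ n) 0 ℚᵘ.* ℚᵘ.mkℚᵘ (+ 1) 1 ≈⟨ ℚᵘₚ.*-cong (toℚᵘ-ℤ→ℚ (+ n)) (toℚᵘ-fromℚᵘ (ℚᵘ.mkℚᵘ (+ 1) 1)) ⟨
    toℚᵘ (ℕ→ℚ n) ℚᵘ.* toℚᵘ ½            ≈⟨ toℚᵘ-homo-* (ℕ→ℚ n) ½ ⟨
    toℚᵘ (ℕ→ℚ n * ½)                    ∎)
  where open ℚᵘₚ.≃-Reasoning

-- Finite sums

Σ<-cong : ∀ n {f g : ℕ → ℚ} → (∀ i → i ℕ.< n → f i ≡ g i) → Σ< n f ≡ Σ< n g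
Σ<-cong zero    f≡g = refl
Σ<-cong (suc n) f≡g = cong₂ _+_ (Σ<-cong n (λ i i<n → f≡g i (ℕₚ.m<n⇒m<1+n i<n))) (f≡g n ℕₚ.≤-refl)

Σ<-ext : ∀ n {f g : ℕ → ℚ} → (∀ i → f i ≡ g i) → Σ< n f ≡ Σ< n g
Σ<-ext n f≡g = Σ<-cong n (λ i _ → f≡g i)

Σ<-zero : ∀ n (f : ℕ → ℚ) → (∀ i → i ℕ.< n → f i ≡ 0ℚ) → Σ< n f ≡ 0ℚ
Σ<-zero zero    f f≡0 = refl
Σ<-zero (suc n) f f≡0 = cong₂ _+_ (Σ<-zero n f (λ i i<n → f≡0 i (ℕₚ.m<n⇒m<1+n i<n))) (f≡0 n ℕₚ.≤-refl)

Σ<-distrib-+ : ∀ n (f g : ℕ → ℚ) → Σ< n (λ i → f i + g i) ≡ Σ< n f + Σ< n g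
Σ<-distrib-+ zero    f g = refl
Σ<-distrib-+ (suc n) f g = trans (cong (_+ (f n + g n)) (Σ<-distrib-+ n f g))
  (solve 4 (λ a b c d → (a :+ b) :+ (c :+ d) := (a :+ c) :+ (b :+ d)) refl (Σ< n f) (Σ< n g) (f n) (g n))

Σ<-neg : ∀ n (f : ℕ → ℚ) → Σ< n (λ i → - f i) ≡ - Σ< n f
Σ<-neg zero    f = refl
Σ<-neg (suc n) f = trans (cong (_+ - f n) (Σ<-neg n f)) (sym (neg-distrib-+ (Σ< n f) (f n)))

Σ<-distrib-sub : ∀ n (f g : ℕ → ℚ) → Σ< n (λ i → f i - g i) ≡ Σ< n f - Σ< n g
Σ<-distrib-sub n f g = trans (Σ<-distrib-+ n f (λ i → - g i)) (cong (_+_ (Σ< n f)) (Σ<-neg n g))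

*-distribˡ-Σ< : ∀ n c (f : ℕ → ℚ) → Σ< n (λ i → c * f i) ≡ c * Σ< n f
*-distribˡ-Σ< zero    c f = sym (*-zeroʳ c)
*-distribˡ-Σ< (suc n) c f = trans (cong (_+ c * f n) (*-distribˡ-Σ< n c f)) (sym (*-distribˡ-+ c (Σ< n f) (f n)))

*-distribʳ-Σ< : ∀ n c (f : ℕ → ℚ) → Σ< n (λ i → f i * c) ≡ Σ< n f * c
*-distribʳ-Σ< n c f = trans (Σ<-ext n (λ i → *-comm (f i) c)) (trans (*-distribˡ-Σ< n c f) (*-comm c (Σ< n f)))

Σ<-shift : ∀ n (f : ℕ → ℚ) → Σ< (suc n) f ≡ f 0 + Σ< n (f ∘ suc)
Σ<-shift zero    f = +-comm 0ℚ (f 0)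
Σ<-shift (suc n) f = trans (cong (_+ f (suc n)) (Σ<-shift n f)) (+-assoc (f 0) _ _)

Σ<-reverse : ∀ n (f : ℕ → ℚ) → Σ< n f ≡ Σ< n (λ i → f (n ℕ.∸ suc i))
Σ<-reverse zero    f = refl
Σ<-reverse (suc n) f = trans (cong (_+ f n) (Σ<-reverse n f))
  (trans (+-comm _ (f n)) (sym (Σ<-shift n (λ i → f (n ℕ.∸ i)))))

Σ<-telescope : ∀ n (f : ℕ → ℚ) → Σ< n f - Σ< n (f ∘ suc) ≡ f 0 - f n
Σ<-telescope n f = begin
    Σ< n f - Σ< n (f ∘ suc)                   ≡⟨ solve 3 (λ a b e → a :- e := (a :+ b) :- b :- e) refl (Σ< n f) (f n) (Σ< n (f ∘ suc)) ⟩
    Σ< (suc n) f - f n - Σ< n (f ∘ suc)       ≡⟨ cong (λ e → e - f n - Σ< n (f ∘ suc)) (Σ<-shift n f) ⟩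
    f 0 + Σ< n (f ∘ suc) - f n - Σ< n (f ∘ suc) ≡⟨ solve 3 (λ a e b → a :+ e :- b :- e := a :- b) refl (f 0) (Σ< n (f ∘ suc)) (f n) ⟩
    f 0 - f n                                 ∎
  where open ≡-Reasoning

Σ<-triangle : ℕ → (ℕ → ℕ → ℚ) → ℚ
Σ<-triangle N f = Σ< N (λ k → Σ< (N ℕ.∸ k) (f k))

Σ<-triangle-suc : ∀ N f → Σ<-triangle (suc N) f ≡ Σ<-triangle N f + Σ< (suc N) (λ k → f k (N ℕ.∸ k))
Σ<-triangle-suc N f = begin
    Σ< (suc N) (λ k → Σ< (suc N ℕ.∸ k) (f k))
      ≡⟨ Σ<-cong (suc N) (λ k k≤N → cong (λ e → Σ< e (f k)) (ℕₚ.+-∸-assoc 1 (ℕₚ.≤-pred k≤N))) ⟩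
    Σ< (suc N) (λ k → Σ< (N ℕ.∸ k) (f k) + f k (N ℕ.∸ k))
      ≡⟨ Σ<-distrib-+ (suc N) _ _ ⟩
    Σ<-triangle N f + Σ< (N ℕ.∸ N) (f N) + Σ< (suc N) (λ k → f k (N ℕ.∸ k))
      ≡⟨ cong (λ e → Σ<-triangle N f + Σ< e (f N) + Σ< (suc N) (λ k → f k (N ℕ.∸ k))) (ℕₚ.n∸n≡0 N) ⟩
    Σ<-triangle N f + 0ℚ + Σ< (suc N) (λ k → f k (N ℕ.∸ k))
      ≡⟨ cong (_+ Σ< (suc N) (λ k → f k (N ℕ.∸ k))) (+-identityʳ (Σ<-triangle N f)) ⟩
    Σ<-triangle N f + Σ< (suc N) (λ k → f k (N ℕ.∸ k)) ∎
  where open ≡-Reasoning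

Σ<-triangle-swap : ∀ N f → Σ<-triangle N f ≡ Σ<-triangle N (λ j k → f k j)
Σ<-triangle-swap zero    f = refl
Σ<-triangle-swap (suc N) f = begin
    Σ<-triangle (suc N) f                                             ≡⟨ Σ<-triangle-suc N f ⟩
    Σ<-triangle N f + Σ< (suc N) (λ k → f k (N ℕ.∸ k))                 ≡⟨ cong₂ _+_ (Σ<-triangle-swap N f) antidiagonal ⟩
    Σ<-triangle N (λ j k → f k j) + Σ< (suc N) (λ k → f (N ℕ.∸ k) k)   ≡⟨ Σ<-triangle-suc N (λ j k → f k j) ⟨
    Σ<-triangle (suc N) (λ j k → f k j)                               ∎
  where
  open ≡-Reasoning
  antidiagonal : Σ< (suc N) (λ k → f k (N ℕ.∸ k)) ≡ Σ< (suc N) (λ k → f (N ℕ.∸ k) k)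
  antidiagonal = trans (Σ<-reverse (suc N) _)
    (Σ<-cong (suc N) (λ i i≤N → cong (f (N ℕ.∸ i)) (ℕₚ.m∸[m∸n]≡n (ℕₚ.≤-pred i≤N))))

pow-distribʳ-* : ∀ x y n → pow (x * y) n ≡ pow x n * pow y n
pow-distribʳ-* x y zero    = refl
pow-distribʳ-* x y (suc n) = trans (cong (_* (x * y)) (pow-distribʳ-* x y n))
  (solve 4 (λ a b x y → (a :* b) :* (x :* y) := (a :* x) :* (b :* y)) refl (pow x n) (pow y n) x y)

pow-zeroˡ : ∀ n → pow 0ℚ (suc n) ≡ 0ℚ
pow-zeroˡ n = *-zeroʳ (pow 0ℚ n)

-- Binomial coefficients and Bernoulli polynomials

nCk*k!*[n∸k]!≡n! : ∀ {n k} → k ℕ.≤ n → (n C k) ℕ.* (k ! ℕ.* (n ℕ.∸ k) !) ≡ n !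
nCk*k!*[n∸k]!≡n! {n} {k} k≤n = trans (cong (ℕ._* (k ! ℕ.* (n ℕ.∸ k) !)) (nCk≡n!/k![n-k]! k≤n))
  (m/n*n≡m {{ℕₚ._!*_!≢0 k (n ℕ.∸ k)}} (k![n∸k]!∣n! k≤n))

[1+n]Cn≡1+n : ∀ n → suc n C n ≡ suc n
[1+n]Cn≡1+n n = trans (nCk≡nC[n∸k] (ℕₚ.n≤1+n n)) (trans (cong (suc n C_) (ℕₚ.m+n∸n≡m 1 n)) (nC1≡n (suc n)))

-- Both sides equal N! / (k! j! (N − k − j)!).
nCk*[n∸k]Cj≡nCj*[n∸j]Ck : ∀ N k j → k ℕ.+ j ℕ.≤ N → (N C k) ℕ.* ((N ℕ.∸ k) C j) ≡ (N C j) ℕ.* ((N ℕ.∸ j) C k)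
nCk*[n∸k]Cj≡nCj*[n∸j]Ck N k j k+j≤N =
  ℕₚ.*-cancelʳ-≡ _ _ (k ! ℕ.* j ! ℕ.* r !) {{ℕₚ.m*n≢0 _ _ {{ℕₚ._!*_!≢0 k j}} {{ℕₚ._!≢0 r}}}}
    (trans (times-factorials k j k≤N j≤N-k) (sym (trans
      (cong ((N C j) ℕ.* ((N ℕ.∸ j) C k) ℕ.*_) (cong₂ ℕ._*_ (ℕₚ.*-comm (k !) (j !)) (cong _! (sym r≡))))
      (times-factorials j k j≤N k≤N-j))))
  where
  r = N ℕ.∸ k ℕ.∸ j
  k≤N = ℕₚ.≤-trans (ℕₚ.m≤m+n k j) k+j≤N
  j≤N = ℕₚ.≤-trans (ℕₚ.m≤n+m j k) k+j≤N
  j≤N-k = ℕₚ.≤-trans (ℕₚ.≤-reflexive (sym (ℕₚ.m+n∸m≡n k j))) (ℕₚ.∸-monoˡ-≤ k k+j≤N)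
  k≤N-j = ℕₚ.≤-trans (ℕₚ.≤-reflexive (sym (ℕₚ.m+n∸n≡m k j))) (ℕₚ.∸-monoˡ-≤ j k+j≤N)
  r≡ : N ℕ.∸ j ℕ.∸ k ≡ r
  r≡ = trans (ℕₚ.∸-+-assoc N j k) (trans (cong (N ℕ.∸_) (ℕₚ.+-comm j k)) (sym (ℕₚ.∸-+-assoc N k j)))
  times-factorials : ∀ a b → a ℕ.≤ N → b ℕ.≤ N ℕ.∸ a →
    (N C a) ℕ.* ((N ℕ.∸ a) C b) ℕ.* (a ! ℕ.* b ! ℕ.* (N ℕ.∸ a ℕ.∸ b) !) ≡ N !
  times-factorials a b a≤N b≤N-a = begin
      (N C a) ℕ.* ((N ℕ.∸ a) C b) ℕ.* (a ! ℕ.* b ! ℕ.* (N ℕ.∸ a ℕ.∸ b) !)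
        ≡⟨ ℕS.solve 5 (λ c c′ x y z → c ℕS.:* c′ ℕS.:* (x ℕS.:* y ℕS.:* z) ℕS.:= c ℕS.:* (x ℕS.:* (c′ ℕS.:* (y ℕS.:* z)))) refl
             (N C a) ((N ℕ.∸ a) C b) (a !) (b !) ((N ℕ.∸ a ℕ.∸ b) !) ⟩
      (N C a) ℕ.* (a ! ℕ.* (((N ℕ.∸ a) C b) ℕ.* (b ! ℕ.* (N ℕ.∸ a ℕ.∸ b) !)))
        ≡⟨ cong (λ e → (N C a) ℕ.* (a ! ℕ.* e)) (nCk*k!*[n∸k]!≡n! b≤N-a) ⟩
      (N C a) ℕ.* (a ! ℕ.* (N ℕ.∸ a) !)
        ≡⟨ nCk*k!*[n∸k]!≡n! a≤N ⟩
      N ! ∎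
    where open ≡-Reasoning

binomial-theorem : ∀ x e → pow (x + 1ℚ) e ≡ Σ< (suc e) (λ j → ℕ→ℚ (e C j) * pow x j)
binomial-theorem x zero    = refl
binomial-theorem x (suc e) = begin
    pow (x + 1ℚ) e * (x + 1ℚ)                                 ≡⟨ cong (_* (x + 1ℚ)) (binomial-theorem x e) ⟩
    Σ< (suc e) a * (x + 1ℚ)                                   ≡⟨ *-distribˡ-+ (Σ< (suc e) a) x 1ℚ ⟩
    Σ< (suc e) a * x + Σ< (suc e) a * 1ℚ                      ≡⟨ cong₂ _+_ (sym (*-distribʳ-Σ< (suc e) x a)) (*-identityʳ _) ⟩
    Σ< (suc e) (λ j → a j * x) + Σ< (suc e) a                 ≡⟨ cong (_+_ (Σ< (suc e) (λ j → a j * x))) (Σ<-shift e a) ⟩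
    Σ< (suc e) (λ j → a j * x) + (a 0 + Σ< e (a ∘ suc))        ≡⟨ solve 3 (λ u a₀ v → u :+ (a₀ :+ v) := a₀ :+ (u :+ (v :+ con 0ℚ))) refl
                                                                     (Σ< (suc e) (λ j → a j * x)) (a 0) (Σ< e (a ∘ suc)) ⟩
    a 0 + (Σ< (suc e) (λ j → a j * x) + (Σ< e (a ∘ suc) + 0ℚ)) ≡⟨ cong (λ t → a 0 + (Σ< (suc e) (λ j → a j * x) + (Σ< e (a ∘ suc) + t))) (sym a[1+e]≡0) ⟩
    a 0 + (Σ< (suc e) (λ j → a j * x) + Σ< (suc e) (a ∘ suc))  ≡⟨ cong (_+_ (a 0)) (sym (Σ<-distrib-+ (suc e) _ _)) ⟩
    a 0 + Σ< (suc e) (λ j → a j * x + a (suc j))              ≡⟨ cong (_+_ (a 0)) (Σ<-ext (suc e) pascal) ⟩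
    a 0 + Σ< (suc e) (b ∘ suc)                                ≡⟨ Σ<-shift (suc e) b ⟨
    Σ< (suc (suc e)) b                                        ∎
  where
  open ≡-Reasoning
  a b : ℕ → ℚ
  a j = ℕ→ℚ (e C j) * pow x j
  b j = ℕ→ℚ (suc e C j) * pow x j
  a[1+e]≡0 : a (suc e) ≡ 0ℚ
  a[1+e]≡0 = trans (cong (λ c → ℕ→ℚ c * pow x (suc e)) (k>n⇒nCk≡0 (ℕₚ.n<1+n e))) (*-zeroˡ (pow x (suc e)))
  pascal : ∀ j → a j * x + a (suc j) ≡ b (suc j)
  pascal j = begin
      ℕ→ℚ (e C j) * pow x j * x + ℕ→ℚ (e C suc j) * (pow x j * x)
        ≡⟨ solve 4 (λ c d p x → c :* p :* x :+ d :* (p :* x) := (c :+ d) :* (p :* x)) refl (ℕ→ℚ (e C j)) (ℕ→ℚ (e C suc j)) (pow x j) x ⟩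
      (ℕ→ℚ (e C j) + ℕ→ℚ (e C suc j)) * (pow x j * x)
        ≡⟨ cong (_* (pow x j * x)) (trans (sym (ℕ→ℚ-homo-+ (e C j) (e C suc j))) (cong ℕ→ℚ (nCk+nC[k+1]≡[n+1]C[k+1] e j))) ⟩
      ℕ→ℚ (suc e C suc j) * (pow x j * x) ∎

binomial-difference : ∀ x e → pow (x + 1ℚ) e - pow x e ≡ Σ< e (λ j → ℕ→ℚ (e C j) * pow x j)
binomial-difference x e = begin
    pow (x + 1ℚ) e - pow x e                  ≡⟨ cong (_- pow x e) (binomial-theorem x e) ⟩
    S + ℕ→ℚ (e C e) * pow x e - pow x e       ≡⟨ cong (λ c → S + ℕ→ℚ c * pow x e - pow x e) (nCn≡1 e) ⟩
    S + 1ℚ * pow x e - pow x e                ≡⟨ solve 2 (λ u p → u :+ con 1ℚ :* p :- p := u) refl S (pow x e) ⟩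
    S                                         ∎
  where
  open ≡-Reasoning
  S = Σ< e (λ j → ℕ→ℚ (e C j) * pow x j)

length-∷ʳ : ∀ {A : Set} (xs : List A) x → length (xs ++ [ x ]) ≡ suc (length xs)
length-∷ʳ xs x = trans (Listₚ.length-++ xs) (ℕₚ.+-comm (length xs) 1)

bernList-length : ∀ n → length (bernList n) ≡ n
bernList-length zero    = refl
bernList-length (suc n) = trans (length-∷ʳ (bernList n) _) (cong suc (bernList-length n))

nth-++ˡ : ∀ (xs ys : List ℚ) i → i ℕ.< length xs → nth (xs ++ ys) i ≡ nth xs i
nth-++ˡ (x ∷ xs) ys zero    _         = refl
nth-++ˡ (x ∷ xs) ys (suc i) (s≤s i<n) = nth-++ˡ xs ys i i<n

nth-∷ʳ : ∀ (xs : List ℚ) y → nth (xs ++ [ y ]) (length xs) ≡ y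
nth-∷ʳ []       y = refl
nth-∷ʳ (x ∷ xs) y = nth-∷ʳ xs y

nth-bernList : ∀ N k → k ℕ.< N → nth (bernList N) k ≡ bernNum k
nth-bernList (suc N) k k<1+N with ℕₚ.m≤n⇒m<n∨m≡n (ℕₚ.≤-pred k<1+N)
... | inj₁ k<N  = trans (nth-++ˡ (bernList N) _ k (subst (k ℕ.<_) (sym (bernList-length N)) k<N)) (nth-bernList N k k<N)
... | inj₂ refl = refl

Σ-binomial-bernNum : ℕ → ℚ
Σ-binomial-bernNum M = Σ< M (λ k → ℕ→ℚ (M C k) * bernNum k)

bernNum-suc : ∀ n → bernNum (suc n) ≡ - (inv (suc (suc n)) * Σ< (suc n) (λ k → ℕ→ℚ (suc (suc n) C k) * bernNum k))
bernNum-suc n = begin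
    nth (bernList (suc n) ++ [ B ]) (suc n)
      ≡⟨ cong (nth (bernList (suc n) ++ [ B ])) (sym (bernList-length (suc n))) ⟩
    nth (bernList (suc n) ++ [ B ]) (length (bernList (suc n)))    ≡⟨ nth-∷ʳ (bernList (suc n)) B ⟩
    B                                                              ≡⟨ cong (λ e → - (inv (suc (suc n)) * e)) (Σ<-cong (suc n) λ k k<1+n →
                                                                        cong (ℕ→ℚ (suc (suc n) C k) *_) (nth-bernList (suc n) k k<1+n)) ⟩
    - (inv (suc (suc n)) * Σ< (suc n) (λ k → ℕ→ℚ (suc (suc n) C k) * bernNum k)) ∎
  where
  open ≡-Reasoning
  B = nextBern (suc n) (bernList (suc n))

Σ-binomial-bernNum-1≡1 : Σ-binomial-bernNum 1 ≡ 1ℚ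
Σ-binomial-bernNum-1≡1 = refl

bernNum-recurrence : ∀ n → Σ-binomial-bernNum (suc (suc n)) ≡ 0ℚ
bernNum-recurrence n = begin
    S + ℕ→ℚ (suc (suc n) C suc n) * bernNum (suc n)  ≡⟨ cong₂ (λ c b → S + ℕ→ℚ c * b) ([1+n]Cn≡1+n (suc n)) (bernNum-suc n) ⟩
    S + N * (- (inv (suc (suc n)) * S))
      ≡⟨ solve 3 (λ S N I → S :+ N :* (:- (I :* S)) := S :- (I :* N) :* S) refl S N (inv (suc (suc n))) ⟩
    S - (inv (suc (suc n)) * N) * S                   ≡⟨ cong (λ e → S - e * S) (inv-inverseˡ (suc (suc n))) ⟩
    S - 1ℚ * S                                        ≡⟨ solve 1 (λ S → S :- con 1ℚ :* S := con 0ℚ) refl S ⟩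
    0ℚ                                                ∎
  where
  open ≡-Reasoning
  N = ℕ→ℚ (suc (suc n))
  S = Σ< (suc n) (λ k → ℕ→ℚ (suc (suc n) C k) * bernNum k)

bernPoly-difference : ∀ n x → bernPoly (suc n) (x + 1ℚ) - bernPoly (suc n) x ≡ ℕ→ℚ (suc n) * pow x n
bernPoly-difference n x = begin
    bernPoly N (x + 1ℚ) - bernPoly N x
      ≡⟨ Σ<-distrib-sub (suc N) _ _ ⟨
    Σ< (suc N) (λ k → c k * pow (x + 1ℚ) (N ℕ.∸ k) - c k * pow x (N ℕ.∸ k))
      ≡⟨ Σ<-ext (suc N) expand ⟩
    Σ< N (λ k → Σ< (N ℕ.∸ k) (f k)) + Σ< (N ℕ.∸ N) (f N)
      ≡⟨ cong (λ e → Σ<-triangle N f + Σ< e (f N)) (ℕₚ.n∸n≡0 N) ⟩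
    Σ<-triangle N f + 0ℚ
      ≡⟨ +-identityʳ _ ⟩
    Σ<-triangle N f
      ≡⟨ Σ<-triangle-swap N f ⟩
    Σ< N (λ j → Σ< (N ℕ.∸ j) (λ k → f k j))
      ≡⟨ Σ<-cong N collect ⟩
    Σ< n g + g n
      ≡⟨ cong₂ _+_ (Σ<-zero n g vanish) (cong₂ (λ a b → pow x n * ℕ→ℚ a * b) ([1+n]Cn≡1+n n) top) ⟩
    0ℚ + pow x n * ℕ→ℚ N * 1ℚ
      ≡⟨ solve 2 (λ p N → con 0ℚ :+ p :* N :* con 1ℚ := N :* p) refl (pow x n) (ℕ→ℚ N) ⟩
    ℕ→ℚ N * pow x n ∎
  where
  open ≡-Reasoning
  N = suc n
  c : ℕ → ℚ
  c k = ℕ→ℚ (N C k) * bernNum k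
  f : ℕ → ℕ → ℚ
  f k j = c k * (ℕ→ℚ ((N ℕ.∸ k) C j) * pow x j)
  g : ℕ → ℚ
  g j = pow x j * ℕ→ℚ (N C j) * Σ-binomial-bernNum (N ℕ.∸ j)

  expand : ∀ k → c k * pow (x + 1ℚ) (N ℕ.∸ k) - c k * pow x (N ℕ.∸ k) ≡ Σ< (N ℕ.∸ k) (f k)
  expand k = begin
      c k * pow (x + 1ℚ) (N ℕ.∸ k) - c k * pow x (N ℕ.∸ k) ≡⟨ solve 3 (λ c a b → c :* a :- c :* b := c :* (a :- b)) refl (c k) _ _ ⟩
      c k * (pow (x + 1ℚ) (N ℕ.∸ k) - pow x (N ℕ.∸ k))     ≡⟨ cong (c k *_) (binomial-difference x (N ℕ.∸ k)) ⟩
      c k * Σ< (N ℕ.∸ k) (λ j → ℕ→ℚ ((N ℕ.∸ k) C j) * pow x j) ≡⟨ *-distribˡ-Σ< (N ℕ.∸ k) (c k) _ ⟨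
      Σ< (N ℕ.∸ k) (f k)                                   ∎

  collect : ∀ j → j ℕ.< N → Σ< (N ℕ.∸ j) (λ k → f k j) ≡ g j
  collect j j<N = trans (Σ<-cong (N ℕ.∸ j) reorder) (*-distribˡ-Σ< (N ℕ.∸ j) (pow x j * ℕ→ℚ (N C j)) _)
    where
    reorder : ∀ k → k ℕ.< N ℕ.∸ j → f k j ≡ pow x j * ℕ→ℚ (N C j) * (ℕ→ℚ ((N ℕ.∸ j) C k) * bernNum k)
    reorder k k<N∸j = begin
        ℕ→ℚ (N C k) * bernNum k * (ℕ→ℚ ((N ℕ.∸ k) C j) * pow x j)
          ≡⟨ solve 4 (λ a B b p → a :* B :* (b :* p) := (a :* b) :* B :* p) refl (ℕ→ℚ (N C k)) (bernNum k) (ℕ→ℚ ((N ℕ.∸ k) C j)) (pow x j) ⟩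
        ℕ→ℚ (N C k) * ℕ→ℚ ((N ℕ.∸ k) C j) * bernNum k * pow x j
          ≡⟨ cong (λ e → e * bernNum k * pow x j) (trans (sym (ℕ→ℚ-homo-* (N C k) ((N ℕ.∸ k) C j)))
               (trans (cong ℕ→ℚ (nCk*[n∸k]Cj≡nCj*[n∸j]Ck N k j k+j≤N)) (ℕ→ℚ-homo-* (N C j) ((N ℕ.∸ j) C k)))) ⟩
        ℕ→ℚ (N C j) * ℕ→ℚ ((N ℕ.∸ j) C k) * bernNum k * pow x j
          ≡⟨ solve 4 (λ a b B p → a :* b :* B :* p := p :* a :* (b :* B)) refl (ℕ→ℚ (N C j)) (ℕ→ℚ ((N ℕ.∸ j) C k)) (bernNum k) (pow x j) ⟩
        pow x j * ℕ→ℚ (N C j) * (ℕ→ℚ ((N ℕ.∸ j) C k) * bernNum k) ∎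
      where
      k+j≤N : k ℕ.+ j ℕ.≤ N
      k+j≤N = ℕₚ.<⇒≤ (subst (k ℕ.+ j ℕ.<_) (ℕₚ.m∸n+n≡m (ℕₚ.<⇒≤ j<N)) (ℕₚ.+-monoˡ-< j k<N∸j))

  vanish : ∀ j → j ℕ.< n → g j ≡ 0ℚ
  vanish j j<n = trans (cong (pow x j * ℕ→ℚ (N C j) *_) (trans (cong Σ-binomial-bernNum N∸j≡2+) (bernNum-recurrence (n ℕ.∸ suc j))))
                       (*-zeroʳ (pow x j * ℕ→ℚ (N C j)))
    where
    N∸j≡2+ : N ℕ.∸ j ≡ suc (suc (n ℕ.∸ suc j))
    N∸j≡2+ = trans (ℕₚ.+-∸-assoc 1 (ℕₚ.<⇒≤ j<n)) (cong suc (ℕₚ.+-∸-assoc 1 j<n))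

  top : Σ-binomial-bernNum (N ℕ.∸ n) ≡ 1ℚ
  top = trans (cong Σ-binomial-bernNum (ℕₚ.m+n∸n≡m 1 n)) Σ-binomial-bernNum-1≡1

-- Polynomial functions

Poly≤ : ℕ → (ℚ → ℚ) → Set
Poly≤ zero    f = ∀ x → f x ≡ f 0ℚ
Poly≤ (suc n) f = ∀ a → Σ (ℚ → ℚ) λ q → Poly≤ n q × (∀ x → f x ≡ f a + (x - a) * q x)

IsPolynomial : (ℚ → ℚ) → Set
IsPolynomial f = ∃ λ n → Poly≤ n f

Poly≤-resp : ∀ n {f g} → (∀ x → f x ≡ g x) → Poly≤ n f → Poly≤ n g
Poly≤-resp zero    f≡g p x = trans (sym (f≡g x)) (trans (p x) (f≡g 0ℚ))
Poly≤-resp (suc n) f≡g p a with p a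
... | q , q-poly , f-expand = q , q-poly , λ x → trans (sym (f≡g x)) (trans (f-expand x) (cong (_+ (x - a) * q x) (f≡g a)))

Poly≤-const : ∀ n c → Poly≤ n (λ _ → c)
Poly≤-const zero    c x = refl
Poly≤-const (suc n) c a = (λ _ → 0ℚ) , Poly≤-const n 0ℚ , λ x → sym (trans (cong (_+_ c) (*-zeroʳ (x - a))) (+-identityʳ c))

Poly≤-mono : ∀ {m n f} → m ℕ.≤ n → Poly≤ m f → Poly≤ n f
Poly≤-mono {zero}  {zero}  _         p = p
Poly≤-mono {zero}  {suc n} {f} _     p a =
  (λ _ → 0ℚ) , Poly≤-const n 0ℚ , λ x → trans (trans (p x) (sym (p a))) (sym (trans (cong (_+_ (f a)) (*-zeroʳ (x - a))) (+-identityʳ (f a))))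
Poly≤-mono {suc m} {suc n} (s≤s m≤n) p a with p a
... | q , q-poly , f-expand = q , Poly≤-mono m≤n q-poly , f-expand

Poly≤-id : Poly≤ 1 (λ x → x)
Poly≤-id a = (λ _ → 1ℚ) , (λ _ → refl) , λ x → solve 2 (λ x a → x := a :+ (x :- a) :* con 1ℚ) refl x a

Poly≤-+ : ∀ n {f g} → Poly≤ n f → Poly≤ n g → Poly≤ n (λ x → f x + g x)
Poly≤-+ zero    p q x = cong₂ _+_ (p x) (q x)
Poly≤-+ (suc n) {f} {g} p q a with p a | q a
... | u , u-poly , f-expand | v , v-poly , g-expand = (λ x → u x + v x) , Poly≤-+ n u-poly v-poly ,
  λ x → trans (cong₂ _+_ (f-expand x) (g-expand x))
    (solve 5 (λ fa ga d u v → fa :+ d :* u :+ (ga :+ d :* v) := fa :+ ga :+ d :* (u :+ v)) refl (f a) (g a) (x - a) (u x) (v x))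

Poly≤-scale : ∀ n c {f} → Poly≤ n f → Poly≤ n (λ x → c * f x)
Poly≤-scale zero    c p x = cong (c *_) (p x)
Poly≤-scale (suc n) c {f} p a with p a
... | u , u-poly , f-expand = (λ x → c * u x) , Poly≤-scale n c u-poly ,
  λ x → trans (cong (c *_) (f-expand x)) (solve 4 (λ c fa d u → c :* (fa :+ d :* u) := c :* fa :+ d :* (c :* u)) refl c (f a) (x - a) (u x))

-- f g − f a g a = (x − a)(u g + f a v) for f = f a + (x − a) u and g = g a + (x − a) v.
Poly≤-* : ∀ m n {f g} → Poly≤ m f → Poly≤ n g → Poly≤ (m ℕ.+ n) (λ x → f x * g x)
Poly≤-* zero    n {f} {g} p q = Poly≤-resp n (λ x → cong (_* g x) (sym (p x))) (Poly≤-scale n (f 0ℚ) q)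
Poly≤-* (suc m) zero {f} {g} p q = subst (λ e → Poly≤ e (λ x → f x * g x)) (sym (ℕₚ.+-identityʳ (suc m)))
  (Poly≤-resp (suc m) (λ x → trans (*-comm (g 0ℚ) (f x)) (cong (f x *_) (sym (q x)))) (Poly≤-scale (suc m) (g 0ℚ) p))
Poly≤-* (suc m) (suc n) {f} {g} p q a with p a | q a
... | u , u-poly , f-expand | v , v-poly , g-expand =
  (λ x → u x * g x + f a * v x) ,
  Poly≤-+ (m ℕ.+ suc n) (Poly≤-* m (suc n) u-poly q)
    (Poly≤-mono (ℕₚ.≤-trans (ℕₚ.n≤1+n n) (ℕₚ.m≤n+m (suc n) m)) (Poly≤-scale n (f a) v-poly)) ,
  λ x → begin
    f x * g x                                           ≡⟨ cong₂ _*_ (f-expand x) (g-expand x) ⟩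
    (f a + (x - a) * u x) * (g a + (x - a) * v x)
      ≡⟨ solve 5 (λ fa ga d u v → (fa :+ d :* u) :* (ga :+ d :* v) := fa :* ga :+ d :* (u :* (ga :+ d :* v) :+ fa :* v))
          refl (f a) (g a) (x - a) (u x) (v x) ⟩
    f a * g a + (x - a) * (u x * (g a + (x - a) * v x) + f a * v x) ≡⟨ cong (λ e → f a * g a + (x - a) * (u x * e + f a * v x)) (sym (g-expand x)) ⟩
    f a * g a + (x - a) * (u x * g x + f a * v x)       ∎
  where open ≡-Reasoning

Poly≤-constant-on-sequence⇒constant : ∀ n {f} → Poly≤ n f → (g : ℕ → ℚ) → Injective _≡_ _≡_ g →
                                      ∀ c → (∀ i → f (g i) ≡ c) → ∀ x → f x ≡ c
Poly≤-constant-on-sequence⇒constant zero    p g g-inj c f∘g≡c x = trans (p x) (trans (sym (p (g 0))) (f∘g≡c 0))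
Poly≤-constant-on-sequence⇒constant (suc n) {f} p g g-inj c f∘g≡c x with p (g 0)
... | q , q-poly , f-expand = begin
    f x                        ≡⟨ f-expand x ⟩
    f (g 0) + (x - g 0) * q x  ≡⟨ cong₂ (λ u v → u + (x - g 0) * v) (f∘g≡c 0) (q≡0 x) ⟩
    c + (x - g 0) * 0ℚ         ≡⟨ solve 2 (λ c d → c :+ d :* con 0ℚ := c) refl c (x - g 0) ⟩
    c                          ∎
  where
  open ≡-Reasoning
  q∘g≡0 : ∀ i → q (g (suc i)) ≡ 0ℚ
  q∘g≡0 i = *-cancel-nonzero (g (suc i) - g 0) (q (g (suc i))) g[1+i]-g0≢0
    (ℚ+.∙-cancelˡ c _ 0ℚ (begin
      c + (g (suc i) - g 0) * q (g (suc i))          ≡⟨ cong (λ u → u + (g (suc i) - g 0) * q (g (suc i))) (sym (f∘g≡c 0)) ⟩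
      f (g 0) + (g (suc i) - g 0) * q (g (suc i))    ≡⟨ sym (f-expand (g (suc i))) ⟩
      f (g (suc i))                                  ≡⟨ f∘g≡c (suc i) ⟩
      c                                              ≡⟨ +-identityʳ c ⟨
      c + 0ℚ                                         ∎))
    where
    g[1+i]-g0≢0 : g (suc i) - g 0 ≢ 0ℚ
    g[1+i]-g0≢0 eq = ℕₚ.1+n≢0 (g-inj (begin
      g (suc i)               ≡⟨ solve 2 (λ p q → p := (p :- q) :+ q) refl (g (suc i)) (g 0) ⟩
      g (suc i) - g 0 + g 0   ≡⟨ cong (_+ g 0) eq ⟩
      0ℚ + g 0                ≡⟨ +-identityˡ (g 0) ⟩
      g 0                     ∎))
    *-cancel-nonzero : ∀ u v → u ≢ 0ℚ → u * v ≡ 0ℚ → v ≡ 0ℚ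
    *-cancel-nonzero u v u≢0 uv≡0 = begin
      v                ≡⟨ *-identityˡ v ⟨
      1ℚ * v           ≡⟨ cong (_* v) (*-inverseˡ u) ⟨
      1/ u * u * v     ≡⟨ *-assoc (1/ u) u v ⟩
      1/ u * (u * v)   ≡⟨ cong (1/ u *_) uv≡0 ⟩
      1/ u * 0ℚ        ≡⟨ *-zeroʳ (1/ u) ⟩
      0ℚ               ∎
      where instance _ = ≢-nonZero u≢0
  q≡0 : ∀ x → q x ≡ 0ℚ
  q≡0 = Poly≤-constant-on-sequence⇒constant n q-poly (g ∘ suc) (ℕₚ.suc-injective ∘ g-inj) 0ℚ q∘g≡0

poly-const : ∀ c → IsPolynomial (λ _ → c)
poly-const c = 0 , Poly≤-const 0 c

poly-id : IsPolynomial (λ x → x)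
poly-id = 1 , Poly≤-id

poly-+ : ∀ {f g} → IsPolynomial f → IsPolynomial g → IsPolynomial (λ x → f x + g x)
poly-+ (m , p) (n , q) = m ℕ.+ n , Poly≤-+ (m ℕ.+ n) (Poly≤-mono (ℕₚ.m≤m+n m n) p) (Poly≤-mono (ℕₚ.m≤n+m n m) q)

poly-* : ∀ {f g} → IsPolynomial f → IsPolynomial g → IsPolynomial (λ x → f x * g x)
poly-* (m , p) (n , q) = m ℕ.+ n , Poly≤-* m n p q

poly-sub : ∀ {f g} → IsPolynomial f → IsPolynomial g → IsPolynomial (λ x → f x - g x)
poly-sub {g = g} p (n , q) = poly-+ p (n , Poly≤-resp n (λ x → solve 1 (λ y → con (- 1ℚ) :* y := :- y) refl (g x)) (Poly≤-scale n (- 1ℚ) q))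

poly-Σ< : ∀ K (F : ℕ → ℚ → ℚ) → (∀ i → IsPolynomial (F i)) → IsPolynomial (λ x → Σ< K (λ i → F i x))
poly-Σ< zero    F F-poly = poly-const 0ℚ
poly-Σ< (suc K) F F-poly = poly-+ (poly-Σ< K F F-poly) (F-poly K)

poly-pow : ∀ {f} → IsPolynomial f → ∀ e → IsPolynomial (λ x → pow (f x) e)
poly-pow p zero    = poly-const 1ℚ
poly-pow p (suc e) = poly-* (poly-pow p e) p

poly-bernPoly∘ : ∀ l {f} → IsPolynomial f → IsPolynomial (λ x → bernPoly l (f x))
poly-bernPoly∘ l p = poly-Σ< (suc l) _ (λ k → poly-* (poly-const (ℕ→ℚ (l C k) * bernNum k)) (poly-pow p (l ℕ.∸ k)))

-- Lists of degrees: W, τ and ξ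

sumN-cong : ∀ n {f g : ℕ → ℕ} → (∀ i → i ℕ.< n → f i ≡ g i) → sumN n f ≡ sumN n g
sumN-cong zero    f≡g = refl
sumN-cong (suc n) f≡g = cong₂ ℕ._+_ (sumN-cong n (λ i i<n → f≡g i (ℕₚ.m<n⇒m<1+n i<n))) (f≡g n ℕₚ.≤-refl)

sumN-distrib-+ : ∀ n (f g : ℕ → ℕ) → sumN n (λ i → f i ℕ.+ g i) ≡ sumN n f ℕ.+ sumN n g
sumN-distrib-+ zero    f g = refl
sumN-distrib-+ (suc n) f g = trans (cong (ℕ._+ (f n ℕ.+ g n)) (sumN-distrib-+ n f g))
  (ℕS.solve 4 (λ a b c d → (a ℕS.:+ b) ℕS.:+ (c ℕS.:+ d) ℕS.:= (a ℕS.:+ c) ℕS.:+ (b ℕS.:+ d)) refl (sumN n f) (sumN n g) (f n) (g n))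

-- multiplication by t^d
shift : ℕ → Series → Series
shift zero    h n       = h n
shift (suc d) h zero    = 0
shift (suc d) h (suc n) = shift d h n

shift-≥ : ∀ d h n → d ℕ.≤ n → shift d h n ≡ h (n ℕ.∸ d)
shift-≥ zero    h n       _         = refl
shift-≥ (suc d) h (suc n) (s≤s d≤n) = shift-≥ d h n d≤n

shift-< : ∀ d h n → n ℕ.< d → shift d h n ≡ 0
shift-< (suc d) h zero    _         = refl
shift-< (suc d) h (suc n) (s≤s n<d) = shift-< d h n n<d

shift-cong : ∀ d {h g} → (∀ n → h n ≡ g n) → ∀ n → shift d h n ≡ shift d g n
shift-cong zero    h≡g n       = h≡g n
shift-cong (suc d) h≡g zero    = refl
shift-cong (suc d) h≡g (suc n) = shift-cong d h≡g n

conv-congʳ : ∀ A {h g} → (∀ n → h n ≡ g n) → ∀ n → conv A h n ≡ conv A g n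
conv-congʳ A h≡g n = sumN-cong (suc n) (λ i _ → cong (A i ℕ.*_) (h≡g (n ℕ.∸ i)))

conv-distribˡ-+ : ∀ A f g n → conv A (λ m → f m ℕ.+ g m) n ≡ conv A f n ℕ.+ conv A g n
conv-distribˡ-+ A f g n = trans (sumN-cong (suc n) (λ i _ → ℕₚ.*-distribˡ-+ (A i) (f (n ℕ.∸ i)) (g (n ℕ.∸ i)))) (sumN-distrib-+ (suc n) _ _)

conv-shift : ∀ d A h n → conv A (shift d h) n ≡ shift d (conv A h) n
conv-shift zero    A h n       = refl
conv-shift (suc d) A h zero    = ℕₚ.*-zeroʳ (A 0)
conv-shift (suc d) A h (suc n) = begin
    sumN (suc n) (λ i → A i ℕ.* shift (suc d) h (suc n ℕ.∸ i)) ℕ.+ A (suc n) ℕ.* shift (suc d) h (suc n ℕ.∸ suc n)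
      ≡⟨ cong₂ ℕ._+_ (sumN-cong (suc n) (λ i i≤n → cong (λ e → A i ℕ.* shift (suc d) h e) (ℕₚ.+-∸-assoc 1 (ℕₚ.≤-pred i≤n))))
                     (trans (cong (λ e → A (suc n) ℕ.* shift (suc d) h e) (ℕₚ.n∸n≡0 (suc n))) (ℕₚ.*-zeroʳ (A (suc n)))) ⟩
    conv A (shift d h) n ℕ.+ 0
      ≡⟨ ℕₚ.+-identityʳ _ ⟩
    conv A (shift d h) n
      ≡⟨ conv-shift d A h n ⟩
    shift d (conv A h) n ∎
  where open ≡-Reasoning

conv-identityʳ : ∀ A n → conv A one n ≡ A n
conv-identityʳ A n = cong₂ ℕ._+_
  (trans (sumN-cong n (λ i i<n → trans (cong (A i ℕ.*_) (one-suc (ℕₚ.m<n⇒0<n∸m i<n))) (ℕₚ.*-zeroʳ (A i)))) (sumN-zeros n))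
  (trans (cong (λ e → A n ℕ.* one e) (ℕₚ.n∸n≡0 n)) (ℕₚ.*-identityʳ (A n)))
  where
  one-suc : ∀ {m} → 0 ℕ.< m → one m ≡ 0
  one-suc {suc m} _ = refl
  sumN-zeros : ∀ n → sumN n (λ _ → 0) ≡ 0
  sumN-zeros zero    = refl
  sumN-zeros (suc n) = trans (ℕₚ.+-identityʳ _) (sumN-zeros n)

geom-cong : ∀ d {m n} → (d ∣ m → d ∣ n) → (d ∣ n → d ∣ m) → geom d m ≡ geom d n
geom-cong d {m} {n} to from with d ∣? m | d ∣? n
... | yes _     | yes _     = refl
... | yes d∣m   | no  d∤n   = ⊥-elim (d∤n (to d∣m))
... | no  d∤m   | yes d∣n   = ⊥-elim (d∤m (from d∣n))
... | no  _     | no  _     = refl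

geom-unfold : ∀ d .{{_ : NonZero d}} n → geom d n ≡ one n ℕ.+ shift d (geom d) n
geom-unfold d@(suc _) zero rewrite dec-true (d ∣? 0) (d ∣0) = refl
geom-unfold d@(suc _) (suc n) with d ℕ.≤? suc n
... | yes d≤1+n = trans (geom-cong d
        (λ d∣1+n → ∣m+n∣m⇒∣n (subst (d ∣_) (sym (ℕₚ.m+[n∸m]≡n d≤1+n)) d∣1+n) (n∣n {d}))
        (λ d∣1+n∸d → subst (d ∣_) (ℕₚ.m+[n∸m]≡n d≤1+n) (∣m∣n⇒∣m+n (n∣n {d}) d∣1+n∸d)))
      (sym (shift-≥ d (geom d) (suc n) d≤1+n))
... | no  d≰1+n rewrite dec-false (d ∣? suc n) (d≰1+n ∘ ∣⇒≤) = sym (shift-< d (geom d) (suc n) (ℕₚ.≰⇒> d≰1+n))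

prodSeries-∷ʳ : ∀ L d .{{_ : NonZero d}} n → prodSeries (L ++ [ d ]) n ≡ prodSeries L n ℕ.+ shift d (prodSeries (L ++ [ d ])) n
prodSeries-∷ʳ [] d n = begin
    conv (geom d) one n                        ≡⟨ conv-identityʳ (geom d) n ⟩
    geom d n                                   ≡⟨ geom-unfold d n ⟩
    one n ℕ.+ shift d (geom d) n               ≡⟨ cong (one n ℕ.+_) (shift-cong d (λ m → sym (conv-identityʳ (geom d) m)) n) ⟩
    one n ℕ.+ shift d (conv (geom d) one) n    ∎
  where open ≡-Reasoning
prodSeries-∷ʳ (a ∷ L) d n = begin
    conv (geom a) (prodSeries (L ++ [ d ])) n
      ≡⟨ conv-congʳ (geom a) (prodSeries-∷ʳ L d) n ⟩
    conv (geom a) (λ m → prodSeries L m ℕ.+ shift d (prodSeries (L ++ [ d ])) m) n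
      ≡⟨ conv-distribˡ-+ (geom a) (prodSeries L) (shift d (prodSeries (L ++ [ d ]))) n ⟩
    conv (geom a) (prodSeries L) n ℕ.+ conv (geom a) (shift d (prodSeries (L ++ [ d ]))) n
      ≡⟨ cong (conv (geom a) (prodSeries L) n ℕ.+_) (conv-shift d (geom a) (prodSeries (L ++ [ d ])) n) ⟩
    conv (geom a) (prodSeries L) n ℕ.+ shift d (conv (geom a) (prodSeries (L ++ [ d ]))) n ∎
  where open ≡-Reasoning

W-recurrence : ∀ L d .{{_ : NonZero d}} n → d ℕ.≤ n → W n (L ++ [ d ]) ≡ W n L ℕ.+ W (n ℕ.∸ d) (L ++ [ d ])
W-recurrence L d n d≤n = trans (prodSeries-∷ʳ L d n) (cong (W n L ℕ.+_) (shift-≥ d _ n d≤n))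

lcm-nonZero : ∀ a b .{{_ : NonZero a}} .{{_ : NonZero b}} → NonZero (lcm a b)
lcm-nonZero a b = ℕ.≢-nonZero λ lcm≡0 → ℕ.≢-nonZero⁻¹ (a ℕ.* b) {{ℕₚ.m*n≢0 a b}}
  (trans (sym (gcd*lcm a b)) (trans (cong (gcd a b ℕ.*_) lcm≡0) (ℕₚ.*-zeroʳ (gcd a b))))

τ-nonZero : ∀ {L} → All NonZero L → NonZero (τ L)
τ-nonZero []                 = _
τ-nonZero {a ∷ L} (a≢0 ∷ L≢0) = lcm-nonZero a (τ L) {{a≢0}} {{τ-nonZero L≢0}}

∣τ-∷ʳ : ∀ L d → d ∣ τ (L ++ [ d ])
∣τ-∷ʳ []      d = m∣lcm[m,n] d 1
∣τ-∷ʳ (a ∷ L) d = ∣-trans (∣τ-∷ʳ L d) (n∣lcm[m,n] a (τ (L ++ [ d ])))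

τ∣τ-∷ʳ : ∀ L d → τ L ∣ τ (L ++ [ d ])
τ∣τ-∷ʳ []      d = 1∣ _
τ∣τ-∷ʳ (a ∷ L) d = lcm-least (m∣lcm[m,n] a (τ (L ++ [ d ]))) (∣-trans (τ∣τ-∷ʳ L d) (n∣lcm[m,n] a (τ (L ++ [ d ]))))

sumL-∷ʳ : ∀ L d → sumL (L ++ [ d ]) ≡ sumL L ℕ.+ d
sumL-∷ʳ []      d = ℕₚ.+-identityʳ d
sumL-∷ʳ (a ∷ L) d = trans (cong (a ℕ.+_) (sumL-∷ʳ L d)) (sym (ℕₚ.+-assoc a (sumL L) d))

-- Periodicity on a coset ξ + ℤ

IsWtilde⇒agrees-with-W : ∀ ds {Wt} → IsWtilde ds Wt → ∀ s → Wt (+ s) ≡ ℕ→ℚ (W s ds)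
IsWtilde⇒agrees-with-W _ (_ , _ , _ , _ , _ , agrees) = agrees

decomposition-as-Σ< : ∀ k → 1 ℕ.≤ k → ∀ (R : ℕ → ℚ) x →
  Σ< k (λ i → pow x i * R (k ℕ.∸ i)) ≡ R k + Σ1 (k ℕ.∸ 1) (λ j → R j * pow x (k ℕ.∸ j))
decomposition-as-Σ< (suc k) _ R x = begin
    Σ< (suc k) (λ i → pow x i * R (suc k ℕ.∸ i))
      ≡⟨ Σ<-reverse (suc k) _ ⟩
    Σ< k (λ i → pow x (k ℕ.∸ i) * R (suc k ℕ.∸ (k ℕ.∸ i))) + pow x (k ℕ.∸ k) * R (suc k ℕ.∸ (k ℕ.∸ k))
      ≡⟨ cong₂ _+_ (Σ<-cong k (λ i i<k → trans (cong (λ e → pow x (k ℕ.∸ i) * R e) (1+k∸[k∸i]≡1+i (ℕₚ.<⇒≤ i<k))) (*-comm (pow x (k ℕ.∸ i)) (R (suc i)))))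
                   (trans (cong (λ e → pow x e * R (suc k ℕ.∸ e)) (ℕₚ.n∸n≡0 k)) (*-identityˡ (R (suc k)))) ⟩
    Σ< k (λ i → R (suc i) * pow x (k ℕ.∸ i)) + R (suc k)
      ≡⟨ +-comm _ (R (suc k)) ⟩
    R (suc k) + Σ1 k (λ j → R j * pow x (suc k ℕ.∸ j)) ∎
  where
  open ≡-Reasoning
  1+k∸[k∸i]≡1+i : ∀ {i} → i ℕ.≤ k → suc k ℕ.∸ (k ℕ.∸ i) ≡ suc i
  1+k∸[k∸i]≡1+i {i} i≤k = trans (ℕₚ.+-∸-assoc 1 (ℕₚ.m∸n≤m k i)) (cong suc (ℕₚ.m∸[m∸n]≡n i≤k))

PeriodicOn : ℚ → ℕ → (ℚ → ℚ) → Set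
PeriodicOn ξ₀ P f = ∀ w → f (ξ₀ + ℤ→ℚ w + ℕ→ℚ P) ≡ f (ξ₀ + ℤ→ℚ w)

periodic-multiple : ∀ {ξ₀ P f} → PeriodicOn ξ₀ P f → ∀ w n → f (ξ₀ + ℤ→ℚ (w ℤ.+ + (n ℕ.* P))) ≡ f (ξ₀ + ℤ→ℚ w)
periodic-multiple {ξ₀} {P} {f} f-per w zero    = cong (λ e → f (ξ₀ + ℤ→ℚ e)) (ℤₚ.+-identityʳ w)
periodic-multiple {ξ₀} {P} {f} f-per w (suc n) = begin
    f (ξ₀ + ℤ→ℚ (w ℤ.+ + (suc n ℕ.* P)))               ≡⟨ cong f one-more-period ⟩
    f (ξ₀ + ℤ→ℚ (w ℤ.+ + (n ℕ.* P)) + ℕ→ℚ P)           ≡⟨ f-per (w ℤ.+ + (n ℕ.* P)) ⟩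
    f (ξ₀ + ℤ→ℚ (w ℤ.+ + (n ℕ.* P)))                   ≡⟨ periodic-multiple {ξ₀} {P} {f} f-per w n ⟩
    f (ξ₀ + ℤ→ℚ w)                                     ∎
  where
  open ≡-Reasoning
  one-more-period : ξ₀ + ℤ→ℚ (w ℤ.+ + (suc n ℕ.* P)) ≡ ξ₀ + ℤ→ℚ (w ℤ.+ + (n ℕ.* P)) + ℕ→ℚ P
  one-more-period = begin
    ξ₀ + ℤ→ℚ (w ℤ.+ + (P ℕ.+ n ℕ.* P))
      ≡⟨ cong (λ e → ξ₀ + ℤ→ℚ (w ℤ.+ e)) (trans (cong +_ (ℕₚ.+-comm P (n ℕ.* P))) (ℤₚ.pos-+ (n ℕ.* P) P)) ⟩
    ξ₀ + ℤ→ℚ (w ℤ.+ (+ (n ℕ.* P) ℤ.+ + P))              ≡⟨ cong (λ e → ξ₀ + ℤ→ℚ e) (sym (ℤₚ.+-assoc w (+ (n ℕ.* P)) (+ P))) ⟩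
    ξ₀ + ℤ→ℚ (w ℤ.+ + (n ℕ.* P) ℤ.+ + P)                ≡⟨ cong (_+_ ξ₀) (ℤ→ℚ-homo-+ (w ℤ.+ + (n ℕ.* P)) (+ P)) ⟩
    ξ₀ + (ℤ→ℚ (w ℤ.+ + (n ℕ.* P)) + ℕ→ℚ P)              ≡⟨ +-assoc ξ₀ (ℤ→ℚ (w ℤ.+ + (n ℕ.* P))) (ℕ→ℚ P) ⟨
    ξ₀ + ℤ→ℚ (w ℤ.+ + (n ℕ.* P)) + ℕ→ℚ P                ∎

periodic-∣ : ∀ {ξ₀ P Q f} → P ∣ Q → PeriodicOn ξ₀ P f → PeriodicOn ξ₀ Q f
periodic-∣ {ξ₀} {P} {Q} {f} (divides c Q≡c*P) f-per w = begin
    f (ξ₀ + ℤ→ℚ w + ℕ→ℚ Q)                 ≡⟨ cong f (sym (trans (cong (_+_ ξ₀) (ℤ→ℚ-homo-+ w (+ Q))) (sym (+-assoc ξ₀ (ℤ→ℚ w) (ℕ→ℚ Q))))) ⟩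
    f (ξ₀ + ℤ→ℚ (w ℤ.+ + Q))               ≡⟨ cong (λ e → f (ξ₀ + ℤ→ℚ (w ℤ.+ + e))) (trans Q≡c*P (sym (ℕₚ.*-identityˡ (c ℕ.* P)))) ⟩
    f (ξ₀ + ℤ→ℚ (w ℤ.+ + (1 ℕ.* (c ℕ.* P)))) ≡⟨ cong (λ e → f (ξ₀ + ℤ→ℚ (w ℤ.+ + e))) (sym (ℕₚ.*-assoc 1 c P)) ⟩
    f (ξ₀ + ℤ→ℚ (w ℤ.+ + (1 ℕ.* c ℕ.* P)))  ≡⟨ periodic-multiple {ξ₀} {P} {f} f-per w (1 ℕ.* c) ⟩
    f (ξ₀ + ℤ→ℚ w)                         ∎
  where open ≡-Reasoning

translate-to-nonnegative : ∀ P .{{_ : NonZero P}} w → ∃ λ N → ∃ λ e → w ℤ.+ + (N ℕ.* P) ≡ + e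
translate-to-nonnegative P (+ a)    = 0 , a , ℤₚ.+-identityʳ (+ a)
translate-to-nonnegative P -[1+ a ] = suc a , suc a ℕ.* P ℕ.∸ suc a , ℤₚ.⊖-≥ (ℕₚ.m≤m*n (suc a) P)

λ'-suc : ∀ p → λ' (suc p) ≡ λ' p + 1ℚ
λ'-suc p = trans (cong (_+ ½) (ℕ→ℚ-homo-+ 1 p)) (solve 2 (λ P h → con 1ℚ :+ P :+ h := P :+ h :+ con 1ℚ) refl (ℕ→ℚ p) ½)

-- The proof, with m = k + 1, d = dₘ, ρ = R^m and r = R^(m−1); pt and ptₖ parametrise ξₘ + ℤ and ξₖ + ℤ.

module Setting (ds : List ℕ) (d : ℕ) .{{_ : NonZero d}} (1≤k : 1 ℕ.≤ length ds) (ds≢0 : All NonZero ds)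
               (Wm Wm1 : ℤ → ℚ) (ρ r : ℕ → ℚ → ℚ)
               (Wm-W̃ : IsWtilde (ds ++ [ d ]) Wm) (Wm1-W̃ : IsWtilde ds Wm1)
               (ρ-decomp : IsRdecomp (ds ++ [ d ]) Wm ρ) (r-decomp : IsRdecomp ds Wm1 r) where

  k τₘ δₘ : ℕ
  k  = length ds
  τₘ = τ (ds ++ [ d ])
  δₘ = δ ds d

  D T ξₘ : ℚ
  D  = ℕ→ℚ d
  T  = ℕ→ℚ τₘ
  ξₘ = ξ (ds ++ [ d ])

  pt ptₖ : ℤ → ℚ
  pt  w = ξₘ + ℤ→ℚ w
  ptₖ w = ξ ds + ℤ→ℚ w

  instance
    τₘ≢0 : NonZero τₘ
    τₘ≢0 = τ-nonZero (++⁺ ds≢0 (ℕ.≢-nonZero (ℕ.≢-nonZero⁻¹ d) ∷ []))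

  d*δₘ≡τₘ : d ℕ.* δₘ ≡ τₘ
  d*δₘ≡τₘ = m*[n/m]≡n (∣τ-∷ʳ ds d)

  instance
    δₘ≢0 : NonZero δₘ
    δₘ≢0 = ℕ.≢-nonZero λ δₘ≡0 → ℕ.≢-nonZero⁻¹ τₘ (trans (sym d*δₘ≡τₘ) (trans (cong (d ℕ.*_) δₘ≡0) (ℕₚ.*-zeroʳ d)))

  T*invδₘ≡D : T * inv δₘ ≡ D
  T*invδₘ≡D = begin
      T * inv δₘ                   ≡⟨ cong (_* inv δₘ) (trans (cong ℕ→ℚ (sym d*δₘ≡τₘ)) (ℕ→ℚ-homo-* d δₘ)) ⟩
      D * ℕ→ℚ δₘ * inv δₘ          ≡⟨ solve 3 (λ D δ ι → D :* δ :* ι := D :* (ι :* δ)) refl D (ℕ→ℚ δₘ) (inv δₘ) ⟩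
      D * (inv δₘ * ℕ→ℚ δₘ)        ≡⟨ cong (D *_) (inv-inverseˡ δₘ) ⟩
      D * 1ℚ                       ≡⟨ *-identityʳ D ⟩
      D                            ∎
    where open ≡-Reasoning

  D*invτₘ≡invδₘ : D * inv τₘ ≡ inv δₘ
  D*invτₘ≡invδₘ = begin
      D * inv τₘ                            ≡⟨ cong (_* inv τₘ) (sym T*invδₘ≡D) ⟩
      T * inv δₘ * inv τₘ                   ≡⟨ solve 3 (λ T ι ω → T :* ι :* ω := ι :* (ω :* T)) refl T (inv δₘ) (inv τₘ) ⟩
      inv δₘ * (inv τₘ * T)                 ≡⟨ cong (inv δₘ *_) (inv-inverseˡ τₘ) ⟩
      inv δₘ * 1ℚ                           ≡⟨ *-identityʳ (inv δₘ) ⟩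
      inv δₘ                                ∎
    where open ≡-Reasoning

  ξₘ≡ξₖ+half-d : ξₘ ≡ ξ ds + half d
  ξₘ≡ξₖ+half-d = begin
      half (sumL (ds ++ [ d ]))            ≡⟨ cong half (sumL-∷ʳ ds d) ⟩
      half (sumL ds ℕ.+ d)                 ≡⟨ half≡*½ (sumL ds ℕ.+ d) ⟩
      ℕ→ℚ (sumL ds ℕ.+ d) * ½              ≡⟨ cong (_* ½) (ℕ→ℚ-homo-+ (sumL ds) d) ⟩
      (ℕ→ℚ (sumL ds) + D) * ½              ≡⟨ *-distribʳ-+ ½ (ℕ→ℚ (sumL ds)) D ⟩
      ℕ→ℚ (sumL ds) * ½ + D * ½            ≡⟨ cong₂ _+_ (half≡*½ (sumL ds)) (half≡*½ d) ⟨
      ξ ds + half d                        ∎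
    where open ≡-Reasoning

  pt-half-d≡ptₖ : ∀ w → pt w - half d ≡ ptₖ w
  pt-half-d≡ptₖ w = trans (cong (λ e → e + ℤ→ℚ w - half d) ξₘ≡ξₖ+half-d)
    (solve 3 (λ ξ h W → ξ :+ h :+ W :- h := ξ :+ W) refl (ξ ds) (half d) (ℤ→ℚ w))

  pt-λ≡ptₖ : ∀ w p → pt w - λ' p * D ≡ ptₖ (w ℤ.- + (p ℕ.* d))
  pt-λ≡ptₖ w p = begin
      ξₘ + ℤ→ℚ w - (ℕ→ℚ p + ½) * D                   ≡⟨ cong (λ e → e + ℤ→ℚ w - (ℕ→ℚ p + ½) * D) ξₘ≡ξₖ+half-d ⟩
      ξ ds + half d + ℤ→ℚ w - (ℕ→ℚ p + ½) * D        ≡⟨ cong (λ e → ξ ds + e + ℤ→ℚ w - (ℕ→ℚ p + ½) * D) (half≡*½ d) ⟩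
      ξ ds + D * ½ + ℤ→ℚ w - (ℕ→ℚ p + ½) * D         ≡⟨ solve 5 (λ ξ D h W P → ξ :+ D :* h :+ W :- (P :+ h) :* D := ξ :+ (W :+ :- (P :* D)))
                                                          refl (ξ ds) D ½ (ℤ→ℚ w) (ℕ→ℚ p) ⟩
      ξ ds + (ℤ→ℚ w + - (ℕ→ℚ p * D))                 ≡⟨ cong (λ e → ξ ds + (ℤ→ℚ w + - e)) (ℕ→ℚ-homo-* p d) ⟨
      ξ ds + (ℤ→ℚ w + - ℕ→ℚ (p ℕ.* d))               ≡⟨ cong (λ e → ξ ds + (ℤ→ℚ w + e)) (ℤ→ℚ-homo‿- (+ (p ℕ.* d))) ⟨
      ξ ds + (ℤ→ℚ w + ℤ→ℚ (ℤ.- + (p ℕ.* d)))         ≡⟨ cong (_+_ (ξ ds)) (ℤ→ℚ-homo-+ w (ℤ.- + (p ℕ.* d))) ⟨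
      ptₖ (w ℤ.- + (p ℕ.* d))                        ∎
    where open ≡-Reasoning

  pt-D≡pt : ∀ w → pt w - D ≡ pt (w ℤ.- + d)
  pt-D≡pt w = begin
      ξₘ + ℤ→ℚ w - D                  ≡⟨ +-assoc ξₘ (ℤ→ℚ w) (- D) ⟩
      ξₘ + (ℤ→ℚ w - D)                ≡⟨ cong (λ e → ξₘ + (ℤ→ℚ w + e)) (ℤ→ℚ-homo‿- (+ d)) ⟨
      ξₘ + (ℤ→ℚ w + ℤ→ℚ (ℤ.- + d))    ≡⟨ cong (_+_ ξₘ) (ℤ→ℚ-homo-+ w (ℤ.- + d)) ⟨
      pt (w ℤ.- + d)                  ∎
    where open ≡-Reasoning

  r-periodic : ∀ j → 1 ℕ.≤ j → j ℕ.≤ k → PeriodicOn (ξ ds) τₘ (r j)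
  r-periodic j 1≤j j≤k = periodic-∣ {ξ ds} {τ ds} {τₘ} {r j} (τ∣τ-∷ʳ ds d) (proj₁ r-decomp j 1≤j j≤k)

  Wm-agrees : ∀ s → Wm (+ s) ≡ ℕ→ℚ (W s (ds ++ [ d ]))
  Wm-agrees = IsWtilde⇒agrees-with-W (ds ++ [ d ]) Wm-W̃

  Wm1-agrees : ∀ s → Wm1 (+ s) ≡ ℕ→ℚ (W s ds)
  Wm1-agrees = IsWtilde⇒agrees-with-W ds Wm1-W̃

  ρ-periodic : ∀ j → 1 ℕ.≤ j → j ℕ.≤ suc k → PeriodicOn ξₘ τₘ (ρ j)
  ρ-periodic j 1≤j j≤1+k = proj₁ ρ-decomp j 1≤j (subst (j ℕ.≤_) (sym (length-∷ʳ ds d)) j≤1+k)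

  arg : ℕ → ℚ → ℚ
  arg p y = 1ℚ - λ' p * inv δₘ + y * inv τₘ

  term : ℕ → ℚ → ℚ → ℕ → ℚ
  term i y u p = bernPoly (suc i) (arg p y) * r (k ℕ.∸ i) (u - λ' p * D)

  coeff : ℕ → ℚ
  coeff i = pow T i * inv (suc i)

  -- i = l − 1 in the sum over l defining 𝓡^m_m
  Ψ : ℚ → ℚ → ℚ
  Ψ y u = Σ< k (λ i → coeff i * Σ< δₘ (term i y u))

  calR≡Ψ₀ : ∀ u → calR ds d r u ≡ Ψ 0ℚ u
  calR≡Ψ₀ u = Σ<-ext k λ i → cong (coeff i *_) (Σ<-ext δₘ λ p →
    cong (λ e → bernPoly (suc i) e * r (k ℕ.∸ i) (u - λ' p * D))
         (solve 2 (λ a ω → con 1ℚ :- a := con 1ℚ :- a :+ con 0ℚ :* ω) refl (λ' p * inv δₘ) (inv τₘ)))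

  term-shift : ∀ i y u p → term i (y - D) (u - D) p ≡ term i y u (suc p)
  term-shift i y u p = cong₂ (λ a b → bernPoly (suc i) a * r (k ℕ.∸ i) b) arg-shift point-shift
    where
    arg-shift : arg p (y - D) ≡ arg (suc p) y
    arg-shift = begin
        1ℚ - λ' p * inv δₘ + (y - D) * inv τₘ
          ≡⟨ solve 5 (λ L ι y D ω → con 1ℚ :- L :* ι :+ (y :- D) :* ω := con 1ℚ :- L :* ι :- D :* ω :+ y :* ω)
              refl (λ' p) (inv δₘ) y D (inv τₘ) ⟩
        1ℚ - λ' p * inv δₘ - D * inv τₘ + y * inv τₘ       ≡⟨ cong (λ e → 1ℚ - λ' p * inv δₘ - e + y * inv τₘ) D*invτₘ≡invδₘ ⟩
        1ℚ - λ' p * inv δₘ - inv δₘ + y * inv τₘ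
          ≡⟨ solve 4 (λ L ι y ω → con 1ℚ :- L :* ι :- ι :+ y :* ω := con 1ℚ :- (L :+ con 1ℚ) :* ι :+ y :* ω)
              refl (λ' p) (inv δₘ) y (inv τₘ) ⟩
        1ℚ - (λ' p + 1ℚ) * inv δₘ + y * inv τₘ             ≡⟨ cong (λ e → 1ℚ - e * inv δₘ + y * inv τₘ) (λ'-suc p) ⟨
        arg (suc p) y                                     ∎
      where open ≡-Reasoning
    point-shift : u - D - λ' p * D ≡ u - λ' (suc p) * D
    point-shift = trans (solve 3 (λ u D L → u :- D :- L :* D := u :- (L :+ con 1ℚ) :* D) refl u D (λ' p))
                        (cong (λ e → u - e * D) (sym (λ'-suc p)))

  X : ℚ → ℚ
  X y = y * inv τₘ - ½ * inv δₘ

  arg-0 : ∀ y → arg 0 y ≡ X y + 1ℚ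
  arg-0 y = solve 4 (λ h ι y ω → con 1ℚ :- (con 0ℚ :+ h) :* ι :+ y :* ω := y :* ω :- h :* ι :+ con 1ℚ) refl ½ (inv δₘ) y (inv τₘ)

  arg-δₘ : ∀ y → arg δₘ y ≡ X y
  arg-δₘ y = begin
      1ℚ - (ℕ→ℚ δₘ + ½) * inv δₘ + y * inv τₘ
        ≡⟨ solve 5 (λ δ h ι y ω → con 1ℚ :- (δ :+ h) :* ι :+ y :* ω := con 1ℚ :- ι :* δ :- h :* ι :+ y :* ω)
            refl (ℕ→ℚ δₘ) ½ (inv δₘ) y (inv τₘ) ⟩
      1ℚ - inv δₘ * ℕ→ℚ δₘ - ½ * inv δₘ + y * inv τₘ    ≡⟨ cong (λ e → 1ℚ - e - ½ * inv δₘ + y * inv τₘ) (inv-inverseˡ δₘ) ⟩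
      1ℚ - 1ℚ - ½ * inv δₘ + y * inv τₘ
        ≡⟨ solve 4 (λ h ι y ω → con 1ℚ :- con 1ℚ :- h :* ι :+ y :* ω := y :* ω :- h :* ι) refl ½ (inv δₘ) y (inv τₘ) ⟩
      X y                                              ∎
    where open ≡-Reasoning

  T*X≡y-half-d : ∀ y → T * X y ≡ y - half d
  T*X≡y-half-d y = begin
      T * (y * inv τₘ - ½ * inv δₘ)
        ≡⟨ solve 5 (λ T y ω h ι → T :* (y :* ω :- h :* ι) := y :* (ω :* T) :- h :* (T :* ι)) refl T y (inv τₘ) ½ (inv δₘ) ⟩
      y * (inv τₘ * T) - ½ * (T * inv δₘ)         ≡⟨ cong₂ (λ a b → y * a - ½ * b) (inv-inverseˡ τₘ) T*invδₘ≡D ⟩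
      y * 1ℚ - ½ * D                              ≡⟨ solve 3 (λ y h D → y :* con 1ℚ :- h :* D := y :- D :* h) refl y ½ D ⟩
      y - D * ½                                   ≡⟨ cong (_-_ y) (half≡*½ d) ⟨
      y - half d                                  ∎
    where open ≡-Reasoning

  -- The ends p = 0 and p = δₘ of the telescope are one period τₘ = δₘ dₘ apart.
  r-ends : ∀ w j → 1 ℕ.≤ j → j ℕ.≤ k → r j (pt w - λ' δₘ * D) ≡ r j (pt w - half d)
  r-ends w j 1≤j j≤k = begin
      r j (pt w - λ' δₘ * D)                               ≡⟨ cong (r j) (pt-λ≡ptₖ w δₘ) ⟩
      r j (ptₖ (w ℤ.- + (δₘ ℕ.* d)))
        ≡⟨ periodic-multiple {ξ ds} {τₘ} {r j} (r-periodic j 1≤j j≤k) (w ℤ.- + (δₘ ℕ.* d)) 1 ⟨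
      r j (ptₖ (w ℤ.- + (δₘ ℕ.* d) ℤ.+ + (1 ℕ.* τₘ)))      ≡⟨ cong (r j ∘ ptₖ) one-period ⟩
      r j (ptₖ w)                                          ≡⟨ cong (r j) (pt-half-d≡ptₖ w) ⟨
      r j (pt w - half d)                                  ∎
    where
    open ≡-Reasoning
    one-period : w ℤ.- + (δₘ ℕ.* d) ℤ.+ + (1 ℕ.* τₘ) ≡ w
    one-period = begin
        w ℤ.- + (δₘ ℕ.* d) ℤ.+ + (1 ℕ.* τₘ)
          ≡⟨ cong (λ e → w ℤ.- + (δₘ ℕ.* d) ℤ.+ + e) (trans (ℕₚ.*-identityˡ τₘ) (trans (sym d*δₘ≡τₘ) (ℕₚ.*-comm d δₘ))) ⟩
        w ℤ.- + (δₘ ℕ.* d) ℤ.+ + (δₘ ℕ.* d)    ≡⟨ ℤS.solve 2 (λ w x → w ℤS.:- x ℤS.:+ x ℤS.:= w) refl w (+ (δₘ ℕ.* d)) ⟩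
        w                                      ∎

  λ'0*D≡half-d : λ' 0 * D ≡ half d
  λ'0*D≡half-d = trans (solve 2 (λ D h → (con 0ℚ :+ h) :* D := D :* h) refl D ½) (sym (half≡*½ d))

  Σ-term-step : ∀ y w i → i ℕ.< k →
    Σ< δₘ (term i y (pt w)) - Σ< δₘ (term i (y - D) (pt w - D))
      ≡ (bernPoly (suc i) (X y + 1ℚ) - bernPoly (suc i) (X y)) * r (k ℕ.∸ i) (pt w - half d)
  Σ-term-step y w i i<k = begin
      Σ< δₘ F - Σ< δₘ (term i (y - D) (pt w - D))   ≡⟨ cong (_-_ (Σ< δₘ F)) (Σ<-ext δₘ (term-shift i y (pt w))) ⟩
      Σ< δₘ F - Σ< δₘ (F ∘ suc)                     ≡⟨ Σ<-telescope δₘ F ⟩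
      F 0 - F δₘ                                    ≡⟨ cong₂ _-_ F-first F-last ⟩
      B (X y + 1ℚ) * r₀ - B (X y) * r₀
        ≡⟨ solve 3 (λ a b r → a :* r :- b :* r := (a :- b) :* r) refl (B (X y + 1ℚ)) (B (X y)) r₀ ⟩
      (B (X y + 1ℚ) - B (X y)) * r₀                 ∎
    where
    open ≡-Reasoning
    j = k ℕ.∸ i
    F = term i y (pt w)
    B = bernPoly (suc i)
    r₀ = r j (pt w - half d)
    F-first : F 0 ≡ B (X y + 1ℚ) * r₀
    F-first = cong₂ (λ a b → B a * r j (pt w - b)) (arg-0 y) λ'0*D≡half-d
    F-last : F δₘ ≡ B (X y) * r₀
    F-last = cong₂ (λ a b → B a * b) (arg-δₘ y) (r-ends w j (ℕₚ.m<n⇒0<n∸m i<k) (ℕₚ.m∸n≤m k i))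

  Ψ-term-step : ∀ y w i → i ℕ.< k →
    coeff i * Σ< δₘ (term i y (pt w)) - coeff i * Σ< δₘ (term i (y - D) (pt w - D))
      ≡ pow (y - half d) i * r (k ℕ.∸ i) (pt w - half d)
  Ψ-term-step y w i i<k = begin
      coeff i * Σ< δₘ (term i y (pt w)) - coeff i * Σ< δₘ (term i (y - D) (pt w - D))
        ≡⟨ solve 3 (λ c a b → c :* a :- c :* b := c :* (a :- b)) refl (coeff i) (Σ< δₘ (term i y (pt w))) (Σ< δₘ (term i (y - D) (pt w - D))) ⟩
      coeff i * (Σ< δₘ (term i y (pt w)) - Σ< δₘ (term i (y - D) (pt w - D)))
        ≡⟨ cong (coeff i *_) (Σ-term-step y w i i<k) ⟩
      coeff i * ((bernPoly (suc i) (X y + 1ℚ) - bernPoly (suc i) (X y)) * r₀)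
        ≡⟨ cong (λ e → coeff i * (e * r₀)) (bernPoly-difference i (X y)) ⟩
      pow T i * inv (suc i) * (ℕ→ℚ (suc i) * pow (X y) i * r₀)
        ≡⟨ solve 5 (λ p I N q r → p :* I :* (N :* q :* r) := I :* N :* (p :* q) :* r) refl (pow T i) (inv (suc i)) (ℕ→ℚ (suc i)) (pow (X y) i) r₀ ⟩
      inv (suc i) * ℕ→ℚ (suc i) * (pow T i * pow (X y) i) * r₀
        ≡⟨ cong₂ (λ a b → a * b * r₀) (inv-inverseˡ (suc i)) (sym (pow-distribʳ-* T (X y) i)) ⟩
      1ℚ * pow (T * X y) i * r₀
        ≡⟨ cong (λ e → 1ℚ * pow e i * r₀) (T*X≡y-half-d y) ⟩
      1ℚ * pow (y - half d) i * r₀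
        ≡⟨ cong (_* r₀) (*-identityˡ (pow (y - half d) i)) ⟩
      pow (y - half d) i * r₀ ∎
    where
    open ≡-Reasoning
    r₀ = r (k ℕ.∸ i) (pt w - half d)

  Ψ-step : ∀ y w → Ψ y (pt w) - Ψ (y - D) (pt w - D)
                    ≡ Σ1 k (λ l → pow (y - half d) (l ℕ.∸ 1) * r (suc k ℕ.∸ l) (pt w - half d))
  Ψ-step y w = trans (sym (Σ<-distrib-sub k _ _)) (Σ<-cong k (Ψ-term-step y w))

  Wm1≡Ψ-step : ∀ w → Wm1 w ≡ Ψ (pt w) (pt w) - Ψ (pt w - D) (pt w - D)
  Wm1≡Ψ-step w = begin
      Wm1 w                                                                 ≡⟨ proj₂ r-decomp w ⟩
      r k (ptₖ w) + Σ1 (k ℕ.∸ 1) (λ j → r j (ptₖ w) * pow (ptₖ w) (k ℕ.∸ j)) ≡⟨ decomposition-as-Σ< k 1≤k (λ j → r j (ptₖ w)) (ptₖ w) ⟨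
      Σ< k (λ i → pow (ptₖ w) i * r (k ℕ.∸ i) (ptₖ w))
        ≡⟨ Σ<-ext k (λ i → cong (λ e → pow e i * r (k ℕ.∸ i) e) (sym (pt-half-d≡ptₖ w))) ⟩
      Σ1 k (λ l → pow (pt w - half d) (l ℕ.∸ 1) * r (suc k ℕ.∸ l) (pt w - half d)) ≡⟨ Ψ-step (pt w) w ⟨
      Ψ (pt w) (pt w) - Ψ (pt w - D) (pt w - D)                             ∎
    where open ≡-Reasoning

  G : ℤ → ℚ
  G w = Wm w - Ψ (pt w) (pt w)

  G-step : ∀ x → G (+ (x ℕ.+ d)) ≡ G (+ x)
  G-step x = begin
      Wm (+ n) - Ψₙ                  ≡⟨ cong (_- Ψₙ) W-split ⟩
      Wm1 (+ n) + Wm (+ x) - Ψₙ      ≡⟨ cong (λ e → e + Wm (+ x) - Ψₙ) Wm1-split ⟩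
      Ψₙ - Ψₓ + Wm (+ x) - Ψₙ        ≡⟨ solve 3 (λ a b c → a :- b :+ c :- a := c :- b) refl Ψₙ Ψₓ (Wm (+ x)) ⟩
      Wm (+ x) - Ψₓ                  ∎
    where
    open ≡-Reasoning
    n = x ℕ.+ d
    Ψₙ = Ψ (pt (+ n)) (pt (+ n))
    Ψₓ = Ψ (pt (+ x)) (pt (+ x))
    W-split : Wm (+ n) ≡ Wm1 (+ n) + Wm (+ x)
    W-split = begin
        Wm (+ n)                                          ≡⟨ Wm-agrees n ⟩
        ℕ→ℚ (W n (ds ++ [ d ]))                           ≡⟨ cong ℕ→ℚ (W-recurrence ds d n (ℕₚ.m≤n+m d x)) ⟩
        ℕ→ℚ (W n ds ℕ.+ W (n ℕ.∸ d) (ds ++ [ d ]))        ≡⟨ ℕ→ℚ-homo-+ (W n ds) _ ⟩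
        ℕ→ℚ (W n ds) + ℕ→ℚ (W (n ℕ.∸ d) (ds ++ [ d ]))    ≡⟨ cong (λ e → ℕ→ℚ (W n ds) + ℕ→ℚ (W e (ds ++ [ d ]))) (ℕₚ.m+n∸n≡m x d) ⟩
        ℕ→ℚ (W n ds) + ℕ→ℚ (W x (ds ++ [ d ]))            ≡⟨ cong₂ _+_ (Wm1-agrees n) (Wm-agrees x) ⟨
        Wm1 (+ n) + Wm (+ x)                              ∎
    pt[n]-D≡pt[x] : pt (+ n) - D ≡ pt (+ x)
    pt[n]-D≡pt[x] = trans (cong (λ e → ξₘ + e - D) (ℕ→ℚ-homo-+ x d))
                          (solve 3 (λ ξ X D → ξ :+ (X :+ D) :- D := ξ :+ X) refl ξₘ (ℕ→ℚ x) D)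
    Wm1-split : Wm1 (+ n) ≡ Ψₙ - Ψₓ
    Wm1-split = trans (Wm1≡Ψ-step (+ n)) (cong (λ e → Ψₙ - Ψ e e) pt[n]-D≡pt[x])

  G-periodic : ∀ x i → G (+ (x ℕ.+ i ℕ.* τₘ)) ≡ G (+ x)
  G-periodic x i = trans (cong (λ e → G (+ (x ℕ.+ e))) i*τₘ≡i*δₘ*d) (G-multiple (i ℕ.* δₘ))
    where
    i*τₘ≡i*δₘ*d : i ℕ.* τₘ ≡ i ℕ.* δₘ ℕ.* d
    i*τₘ≡i*δₘ*d = trans (cong (i ℕ.*_) (trans (sym d*δₘ≡τₘ) (ℕₚ.*-comm d δₘ))) (sym (ℕₚ.*-assoc i δₘ d))
    G-multiple : ∀ j → G (+ (x ℕ.+ j ℕ.* d)) ≡ G (+ x)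
    G-multiple zero    = cong (λ e → G (+ e)) (ℕₚ.+-identityʳ x)
    G-multiple (suc j) = trans (cong (λ e → G (+ e)) (trans (cong (x ℕ.+_) (ℕₚ.+-comm d (j ℕ.* d))) (sym (ℕₚ.+-assoc x (j ℕ.* d) d))))
                               (trans (G-step (x ℕ.+ j ℕ.* d)) (G-multiple j))

  ρ-poly : ℚ → ℚ → ℚ
  ρ-poly t y = ρ (suc k) t + Σ1 k (λ j → ρ j t * pow y (suc k ℕ.∸ j))

  Wm≡ρ-poly : ∀ z → Wm z ≡ ρ-poly (pt z) (pt z)
  Wm≡ρ-poly z = subst (λ n → Wm z ≡ ρ n (pt z) + Σ1 (n ℕ.∸ 1) (λ j → ρ j (pt z) * pow (pt z) (n ℕ.∸ j)))
                      (length-∷ʳ ds d) (proj₂ ρ-decomp z)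

  H : ℚ → ℚ → ℚ
  H t y = ρ-poly t y - Ψ y t

  H-polynomial : ∀ t → IsPolynomial (H t)
  H-polynomial t = poly-sub ρ-poly-polynomial Ψ-polynomial
    where
    ρ-poly-polynomial : IsPolynomial (ρ-poly t)
    ρ-poly-polynomial = poly-+ (poly-const (ρ (suc k) t))
      (poly-Σ< k (λ i y → ρ (suc i) t * pow y (k ℕ.∸ i)) (λ i → poly-* (poly-const (ρ (suc i) t)) (poly-pow poly-id (k ℕ.∸ i))))
    arg-polynomial : ∀ p → IsPolynomial (arg p)
    arg-polynomial p = poly-+ (poly-const (1ℚ - λ' p * inv δₘ)) (poly-* poly-id (poly-const (inv τₘ)))
    Ψ-polynomial : IsPolynomial (λ y → Ψ y t)
    Ψ-polynomial = poly-Σ< k (λ i y → coeff i * Σ< δₘ (term i y t)) λ i →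
      poly-* (poly-const (coeff i)) (poly-Σ< δₘ (λ p y → term i y t p) λ p →
        poly-* (poly-bernPoly∘ (suc i) (arg-polynomial p)) (poly-const (r (k ℕ.∸ i) (t - λ' p * D))))

  Ψ-periodic : ∀ y w n → Ψ y (pt (w ℤ.+ + (n ℕ.* τₘ))) ≡ Ψ y (pt w)
  Ψ-periodic y w n = Σ<-cong k λ i i<k → cong (coeff i *_) (Σ<-ext δₘ λ p →
    cong (bernPoly (suc i) (arg p y) *_) (r-at-shifted-point i<k p))
    where
    r-at-shifted-point : ∀ {i} → i ℕ.< k → ∀ p → r (k ℕ.∸ i) (pt (w ℤ.+ + (n ℕ.* τₘ)) - λ' p * D) ≡ r (k ℕ.∸ i) (pt w - λ' p * D)
    r-at-shifted-point {i} i<k p = begin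
        r j (pt (w ℤ.+ + (n ℕ.* τₘ)) - λ' p * D)             ≡⟨ cong (r j) (pt-λ≡ptₖ (w ℤ.+ + (n ℕ.* τₘ)) p) ⟩
        r j (ptₖ (w ℤ.+ + (n ℕ.* τₘ) ℤ.- + (p ℕ.* d)))
          ≡⟨ cong (r j ∘ ptₖ) (ℤS.solve 3 (λ a b c → a ℤS.:+ c ℤS.:- b ℤS.:= a ℤS.:- b ℤS.:+ c) refl w (+ (p ℕ.* d)) (+ (n ℕ.* τₘ))) ⟩
        r j (ptₖ (w ℤ.- + (p ℕ.* d) ℤ.+ + (n ℕ.* τₘ)))
          ≡⟨ periodic-multiple {ξ ds} {τₘ} {r j} (r-periodic j (ℕₚ.m<n⇒0<n∸m i<k) (ℕₚ.m∸n≤m k i)) (w ℤ.- + (p ℕ.* d)) n ⟩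
        r j (ptₖ (w ℤ.- + (p ℕ.* d)))                        ≡⟨ cong (r j) (pt-λ≡ptₖ w p) ⟨
        r j (pt w - λ' p * D)                                ∎
      where
      open ≡-Reasoning
      j = k ℕ.∸ i

  ρ-poly-periodic : ∀ y w n → ρ-poly (pt (w ℤ.+ + (n ℕ.* τₘ))) y ≡ ρ-poly (pt w) y
  ρ-poly-periodic y w n = cong₂ _+_ (ρ-at-shifted-point (suc k) (s≤s z≤n) ℕₚ.≤-refl)
    (Σ<-cong k λ i i<k → cong (_* pow y (k ℕ.∸ i)) (ρ-at-shifted-point (suc i) (s≤s z≤n) (s≤s (ℕₚ.<⇒≤ i<k))))
    where
    ρ-at-shifted-point : ∀ j → 1 ℕ.≤ j → j ℕ.≤ suc k → ρ j (pt (w ℤ.+ + (n ℕ.* τₘ))) ≡ ρ j (pt w)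
    ρ-at-shifted-point j 1≤j j≤1+k = periodic-multiple {ξₘ} {τₘ} {ρ j} (ρ-periodic j 1≤j j≤1+k) w n

  H-on-lattice : ∀ w n → H (pt w) (pt (w ℤ.+ + (n ℕ.* τₘ))) ≡ G (w ℤ.+ + (n ℕ.* τₘ))
  H-on-lattice w n = begin
      ρ-poly (pt w) y - Ψ y (pt w)      ≡⟨ cong₂ _-_ (sym (ρ-poly-periodic y w n)) (sym (Ψ-periodic y w n)) ⟩
      ρ-poly y y - Ψ y y                ≡⟨ cong (_- Ψ y y) (sym (Wm≡ρ-poly (w ℤ.+ + (n ℕ.* τₘ)))) ⟩
      G (w ℤ.+ + (n ℕ.* τₘ))            ∎
    where
    open ≡-Reasoning
    y = pt (w ℤ.+ + (n ℕ.* τₘ))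

  -- H (pt w) agrees with G at the points pt w + (N + i) τₘ, where w + N τₘ ≥ 0, and there G is constant by periodicity.
  H-constant : ∀ w y y′ → H (pt w) y ≡ H (pt w) y′
  H-constant w y y′ = trans (H≡G[e] y) (sym (H≡G[e] y′))
    where
    N = proj₁ (translate-to-nonnegative τₘ w)
    e = proj₁ (proj₂ (translate-to-nonnegative τₘ w))
    w+Nτ≡e = proj₂ (proj₂ (translate-to-nonnegative τₘ w))
    point : ℕ → ℚ
    point i = pt (w ℤ.+ + ((N ℕ.+ i) ℕ.* τₘ))
    lattice≡ : ∀ i → w ℤ.+ + ((N ℕ.+ i) ℕ.* τₘ) ≡ + (e ℕ.+ i ℕ.* τₘ)
    lattice≡ i = begin
        w ℤ.+ + ((N ℕ.+ i) ℕ.* τₘ)                   ≡⟨ cong (λ z → w ℤ.+ + z) (ℕₚ.*-distribʳ-+ τₘ N i) ⟩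
        w ℤ.+ + (N ℕ.* τₘ ℕ.+ i ℕ.* τₘ)              ≡⟨ cong (ℤ._+_ w) (ℤₚ.pos-+ (N ℕ.* τₘ) (i ℕ.* τₘ)) ⟩
        w ℤ.+ (+ (N ℕ.* τₘ) ℤ.+ + (i ℕ.* τₘ))        ≡⟨ sym (ℤₚ.+-assoc w (+ (N ℕ.* τₘ)) (+ (i ℕ.* τₘ))) ⟩
        w ℤ.+ + (N ℕ.* τₘ) ℤ.+ + (i ℕ.* τₘ)          ≡⟨ cong (ℤ._+ + (i ℕ.* τₘ)) w+Nτ≡e ⟩
        + e ℤ.+ + (i ℕ.* τₘ)                         ≡⟨ sym (ℤₚ.pos-+ e (i ℕ.* τₘ)) ⟩
        + (e ℕ.+ i ℕ.* τₘ)                           ∎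
      where open ≡-Reasoning
    H≡G[e]-on-points : ∀ i → H (pt w) (point i) ≡ G (+ e)
    H≡G[e]-on-points i = trans (H-on-lattice w (N ℕ.+ i)) (trans (cong G (lattice≡ i)) (G-periodic e i))
    point-injective : Injective _≡_ _≡_ point
    point-injective {i} {j} eq = ℕₚ.+-cancelˡ-≡ N i j (ℕₚ.*-cancelʳ-≡ (N ℕ.+ i) (N ℕ.+ j) τₘ
      (ℤₚ.+-injective (ℤ+.∙-cancelˡ w _ _ (ℤ→ℚ-injective (ℚ+.∙-cancelˡ ξₘ _ _ eq)))))
    H≡G[e] : ∀ y → H (pt w) y ≡ G (+ e)
    H≡G[e] = Poly≤-constant-on-sequence⇒constant (proj₁ (H-polynomial (pt w))) (proj₂ (H-polynomial (pt w)))
               point point-injective (G (+ e)) H≡G[e]-on-points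

  ρ-poly-difference : ∀ t y → ρ-poly t y - ρ-poly t 0ℚ ≡ Σ1 k (λ j → pow y j * ρ (suc k ℕ.∸ j) t)
  ρ-poly-difference t y = begin
      ρ (suc k) t + Σ< k f - (ρ (suc k) t + Σ< k f₀)      ≡⟨ cong (λ e → ρ (suc k) t + Σ< k f - (ρ (suc k) t + e)) (Σ<-zero k f₀ f₀≡0) ⟩
      ρ (suc k) t + Σ< k f - (ρ (suc k) t + 0ℚ)           ≡⟨ solve 2 (λ a b → a :+ b :- (a :+ con 0ℚ) := b) refl (ρ (suc k) t) (Σ< k f) ⟩
      Σ< k f                                              ≡⟨ Σ<-reverse k f ⟩
      Σ< k (λ i → f (k ℕ.∸ suc i))                        ≡⟨ Σ<-cong k reindex ⟩
      Σ1 k (λ j → pow y j * ρ (suc k ℕ.∸ j) t)            ∎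
    where
    open ≡-Reasoning
    f f₀ : ℕ → ℚ
    f  i = ρ (suc i) t * pow y   (k ℕ.∸ i)
    f₀ i = ρ (suc i) t * pow 0ℚ (k ℕ.∸ i)
    f₀≡0 : ∀ i → i ℕ.< k → f₀ i ≡ 0ℚ
    f₀≡0 i i<k = trans (cong (λ e → ρ (suc i) t * pow 0ℚ e) (ℕₚ.+-∸-assoc 1 i<k))
                       (trans (cong (ρ (suc i) t *_) (pow-zeroˡ (k ℕ.∸ suc i))) (*-zeroʳ (ρ (suc i) t)))
    reindex : ∀ i → i ℕ.< k → f (k ℕ.∸ suc i) ≡ pow y (suc i) * ρ (k ℕ.∸ i) t
    reindex i i<k = trans (cong₂ (λ a b → ρ a t * pow y b) (sym (ℕₚ.+-∸-assoc 1 i<k)) (ℕₚ.m∸[m∸n]≡n i<k))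
                          (*-comm (ρ (k ℕ.∸ i) t) (pow y (suc i)))

  Ψ-step₀ : ∀ z → Ψ 0ℚ (pt z) - Ψ (- D) (pt z - D) ≡ Σ1 k (λ j → pow (- half d) (j ℕ.∸ 1) * r (suc k ℕ.∸ j) (pt z - half d))
  Ψ-step₀ z = begin
      Ψ 0ℚ (pt z) - Ψ (- D) (pt z - D)       ≡⟨ cong (λ e → Ψ 0ℚ (pt z) - Ψ e (pt z - D)) (+-identityˡ (- D)) ⟨
      Ψ 0ℚ (pt z) - Ψ (0ℚ - D) (pt z - D)    ≡⟨ Ψ-step 0ℚ z ⟩
      Σ1 k (λ j → pow (0ℚ - half d) (j ℕ.∸ 1) * r (suc k ℕ.∸ j) (pt z - half d))
                                             ≡⟨ Σ<-ext k (λ i → cong (λ e → pow e i * r (k ℕ.∸ i) (pt z - half d)) (+-identityˡ (- half d))) ⟩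
      Σ1 k (λ j → pow (- half d) (j ℕ.∸ 1) * r (suc k ℕ.∸ j) (pt z - half d)) ∎
    where open ≡-Reasoning

  Ψ-translation-defect : ∀ z → Ψ (- D) (pt z - D) - Ψ 0ℚ (pt z - D) ≡ Σ1 k (λ j → pow (- D) j * ρ (suc k ℕ.∸ j) (pt z - D))
  Ψ-translation-defect z rewrite pt-D≡pt z = begin
      Ψ (- D) t - Ψ 0ℚ t
        ≡⟨ solve 4 (λ a b c e → a :- b := (c :- e) :+ ((e :- b) :- (c :- a))) refl (Ψ (- D) t) (Ψ 0ℚ t) (ρ-poly t (- D)) (ρ-poly t 0ℚ) ⟩
      ρ-poly t (- D) - ρ-poly t 0ℚ + (H t 0ℚ - H t (- D))
        ≡⟨ cong (λ e → ρ-poly t (- D) - ρ-poly t 0ℚ + (e - H t (- D))) (H-constant (z ℤ.- + d) 0ℚ (- D)) ⟩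
      ρ-poly t (- D) - ρ-poly t 0ℚ + (H t (- D) - H t (- D))
        ≡⟨ solve 2 (λ a b → a :+ (b :- b) := a) refl (ρ-poly t (- D) - ρ-poly t 0ℚ) (H t (- D)) ⟩
      ρ-poly t (- D) - ρ-poly t 0ℚ                             ≡⟨ ρ-poly-difference t (- D) ⟩
      Σ1 k (λ j → pow (- D) j * ρ (suc k ℕ.∸ j) t)             ∎
    where
    open ≡-Reasoning
    t = pt (z ℤ.- + d)

lemma5p3 : (ds : List ℕ) (dm : ℕ) .{{_ : NonZero dm}} →
    1 ≤ length ds → All NonZero ds →
    (Wm Wm1 : ℤ → ℚ) (Rm Rm1 : ℕ → ℚ → ℚ) →
    IsWtilde (ds ++ [ dm ]) Wm → IsWtilde ds Wm1 →
    IsRdecomp (ds ++ [ dm ]) Wm Rm → IsRdecomp ds Wm1 Rm1 →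
    ∀ (z : ℤ) →
      let s = ξ (ds ++ [ dm ]) + ℤ→ℚ z
          m = length (ds ++ [ dm ])
      in calR ds dm Rm1 s - calR ds dm Rm1 (s - ℕ→ℚ dm)
         ≡ Σ1 (m ∸ 1) (λ j →
              pow (- ℕ→ℚ dm) j * Rm (m ∸ j) (s - ℕ→ℚ dm)
              + pow (- half dm) (j ∸ 1) * Rm1 (m ∸ j) (s - half dm))
lemma5p3 ds dm 1≤k ds≢0 Wm Wm1 Rm Rm1 Wm-W̃ Wm1-W̃ Rm-decomp Rm1-decomp z =
  subst (λ m → lhs ≡ Σ1 (m ∸ 1) (λ j → summand (m ∸ j) j)) (sym (length-∷ʳ ds dm)) (begin
    calR ds dm Rm1 s - calR ds dm Rm1 (s - D)
      ≡⟨ cong₂ _-_ (calR≡Ψ₀ s) (calR≡Ψ₀ (s - D)) ⟩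
    Ψ 0ℚ s - Ψ 0ℚ (s - D)
      ≡⟨ solve 3 (λ a b c → a :- c := (a :- b) :+ (b :- c)) refl (Ψ 0ℚ s) (Ψ (- D) (s - D)) (Ψ 0ℚ (s - D)) ⟩
    (Ψ 0ℚ s - Ψ (- D) (s - D)) + (Ψ (- D) (s - D) - Ψ 0ℚ (s - D))
      ≡⟨ cong₂ _+_ (Ψ-step₀ z) (Ψ-translation-defect z) ⟩
    Σ1 k r-part + Σ1 k ρ-part
      ≡⟨ +-comm (Σ1 k r-part) (Σ1 k ρ-part) ⟩
    Σ1 k ρ-part + Σ1 k r-part
      ≡⟨ Σ<-distrib-+ k (ρ-part ∘ suc) (r-part ∘ suc) ⟨
    Σ1 k (λ j → summand (suc k ∸ j) j) ∎)
  where
  open Setting ds dm 1≤k ds≢0 Wm Wm1 Rm Rm1 Wm-W̃ Wm1-W̃ Rm-decomp Rm1-decomp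
  open ≡-Reasoning
  s = pt z
  lhs = calR ds dm Rm1 s - calR ds dm Rm1 (s - D)
  ρ-part r-part : ℕ → ℚ
  ρ-part j = pow (- D) j * Rm (suc k ∸ j) (s - D)
  r-part j = pow (- half dm) (j ∸ 1) * Rm1 (suc k ∸ j) (s - half dm)
  summand : ℕ → ℕ → ℚ
  summand i j = pow (- D) j * Rm i (s - D) + pow (- half dm) (j ∸ 1) * Rm1 i (s - half dm)
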